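{- Let $G$ be a bipartite graph with partite sets $A$ and $B$, and let $M$ be a maximum matching in $G$. Every maximum matching in $G$ is uniquely restricted if and only if $D(M)$ is acyclic and the two induced subgraphs $G[V^+(M)]$ and $G[V^-(M)]$ are forests.
   Context: Graphs are finite and simple. A matching $M$ in a graph $G$ is uniquely restricted if there is no matching $M'$ in $G$ with $M'\neq M$ covering exactly the same set of vertices as $M$. For a bipartite graph $G$ with (fixed) partite sets $A$, $B$ and a matching $M$, let $D(M)$ be the digraph with vertex set $V(G)$ and arcs $(a,b)$ for $a\in A$, $b\in B$, $ab\in E(G)\setminus M$, and $(b,a)$ for $a\in A$, $b\in B$, $ab\in M$. Let $A_0(M)$ be the set of vertices of $A$ not covered by $M$ and $B_0(M)$ the set of vertices of $B$ not covered by $M$. Let $V^+(M)$ be the set of vertices $v$ such that $D(M)$ contains a directed path (possibly of length zero) from some vertex of $A_0(M)$ to $v$, and $V^-(M)$ the set of vertices $w$ such that $D(M)$ contains a directed path (possibly of length zero) from $w$ to some vertex of $B_0(M)$. -}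

module Defs where

open import Data.Bool using (Bool; true; false; T; not; _∧_)
open import Data.Nat using (ℕ; _≤_; _<ᵇ_)
open import Data.Fin using (Fin; toℕ)
open import Data.List using (List; []; _∷_; _++_; length; filterᵇ; cartesianProduct; allFin)
open import Data.List.Relation.Unary.All using (All)
open import Data.List.Relation.Unary.Linked using (Linked)
open import Data.List.Relation.Unary.Unique.Propositional using (Unique)
open import Data.Sum using (_⊎_)
open import Data.Product using (Σ; ∃; _×_; _,_)
open import Relation.Nullary using (¬_)
open import Relation.Binary.PropositionalEquality using (_≡_; _≢_)
open import Relation.Binary.Construct.Closure.ReflexiveTransitive using (Star)
open import Relation.Binary.Construct.Closure.Transitive using (TransClosure)

record Graph (n : ℕ) : Set where
  field
    adj    : Fin n → Fin n → Bool
    sym    : ∀ u v → adj u v ≡ adj v u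
    irrefl : ∀ v → adj v v ≡ false
open Graph public

Adj : ∀ {n} → Graph n → Fin n → Fin n → Set
Adj G u v = T (adj G u v)

Side : ℕ → Set
Side n = Fin n → Bool

InA InB : ∀ {n} → Side n → Fin n → Set
InA side v = side v ≡ true
InB side v = side v ≡ false

IsBipartite : ∀ {n} → Graph n → Side n → Set
IsBipartite G side = ∀ u v → Adj G u v → side u ≢ side v

record Matching {n} (G : Graph n) : Set where
  field
    mat    : Fin n → Fin n → Bool
    sub    : ∀ u v → T (mat u v) → Adj G u v
    msym   : ∀ u v → mat u v ≡ mat v u
    unique : ∀ u v w → T (mat u v) → T (mat u w) → v ≡ w
open Matching public

InM : ∀ {n} {G : Graph n} → Matching G → Fin n → Fin n → Set
InM M u v = T (mat M u v)

-- Number of edges of M (unordered pairs {u,v}, counted with u < v).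
size : ∀ {n} {G : Graph n} → Matching G → ℕ
size {n} M = length (filterᵇ (λ { (u , v) → mat M u v ∧ (toℕ u <ᵇ toℕ v) })
                             (cartesianProduct (allFin n) (allFin n)))

IsMaximum : ∀ {n} {G : Graph n} → Matching G → Set
IsMaximum {G = G} M = ∀ (M' : Matching G) → size M' ≤ size M

Covered : ∀ {n} {G : Graph n} → Matching G → Fin n → Set
Covered M v = ∃ λ u → InM M v u

SameEdges : ∀ {n} {G : Graph n} → Matching G → Matching G → Set
SameEdges M M' = ∀ u v → mat M u v ≡ mat M' u v

SameCover : ∀ {n} {G : Graph n} → Matching G → Matching G → Set
SameCover M M' = ∀ v → (Covered M v → Covered M' v) × (Covered M' v → Covered M v)

UniquelyRestricted : ∀ {n} {G : Graph n} → Matching G → Set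
UniquelyRestricted {G = G} M =
  ¬ (Σ (Matching G) λ M' → SameCover M M' × ¬ SameEdges M M')

Arc : ∀ {n} (G : Graph n) → Side n → Matching G → Fin n → Fin n → Set
Arc G side M x y =
    (InA side x × InB side y × Adj G x y × ¬ InM M x y)
  ⊎ (InB side x × InA side y × InM M x y)

-- D(M) is acyclic: no directed closed walk of positive length (equivalently no directed cycle).
Acyclic : ∀ {n} → (Fin n → Fin n → Set) → Set
Acyclic {n} R = ∀ (x : Fin n) → ¬ TransClosure R x x

Reach : ∀ {n} → (Fin n → Fin n → Set) → Fin n → Fin n → Set
Reach R = Star R

A₀ B₀ : ∀ {n} {G : Graph n} → Side n → Matching G → Fin n → Set
A₀ side M v = InA side v × ¬ Covered M v
B₀ side M v = InB side v × ¬ Covered M v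

V⁺ : ∀ {n} (G : Graph n) → Side n → Matching G → Fin n → Set
V⁺ G side M v = ∃ λ a → A₀ side M a × Reach (Arc G side M) a v

V⁻ : ∀ {n} (G : Graph n) → Side n → Matching G → Fin n → Set
V⁻ G side M w = ∃ λ b → B₀ side M b × Reach (Arc G side M) w b

-- A cycle of G lying in a vertex set S (i.e. a cycle of the induced subgraph G[S]):
-- distinct vertices x, v₁, …, v_k (k ≥ 2), consecutive ones adjacent, and v_k adjacent to x.
record CycleIn {n} (G : Graph n) (S : Fin n → Set) : Set where
  field
    start  : Fin n
    rest   : List (Fin n)
    long   : 2 ≤ length rest
    distinct : Unique (start ∷ rest)
    inS    : All S (start ∷ rest)
    closed : Linked (Adj G) (start ∷ (rest ++ (start ∷ [])))

IsForest : ∀ {n} (G : Graph n) → (Fin n → Set) → Set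
IsForest G S = ¬ CycleIn G S

module Submission where

-- Sizes of matchings are compared through covered vertices (2·|N| = #covered,
-- 'twice-size').  The key operation is 'shift': moving a matching N along a path
-- of D(N) from an uncovered A-vertex; it keeps the size if the path ends in A and
-- augments N if it ends at an uncovered B-vertex.  A cycle C in G[V⁺(M)] is refuted
--   (NoCycleInV⁺) by descent on the number of vertices of C not matched along C;
--   V⁻ follows by exchanging the sides.
-- (⇐) (Converse) For maximum N, a closed walk of D(N) lies in V⁺(N) or in V⁻(N)
--   (a cycle in one of the forests, by invariance), or carries over to D(M), or
--   meets a vertex outside V⁺ ∪ V⁻ where N and M differ, which starts an endless
--   walk of D(M).  So D(N) is acyclic and N is uniquely restricted.

open import Defs
open import Data.Bool using (Bool; true; false; T; T?; not; _∧_; _∨_)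
open import Data.Bool.Properties using (T-≡; T-∧; T-∨; ∧-comm; ∨-comm; not-injective)
open import Data.Empty using (⊥; ⊥-elim)
open import Data.Fin using (Fin; zero; suc; toℕ; _≟_)
open import Data.Fin.Properties using (any?; toℕ-injective; pigeonhole) renaming (suc-injective to Fin-suc-injective)
open import Data.List using (List; []; _∷_; _++_; length; filterᵇ; cartesianProduct; tabulate; map)
open import Data.List.Properties using (++-assoc; ++-identityʳ; length-++; filter-++)
open import Data.List.Membership.Propositional using (_∈_; _∉_)
open import Data.List.Membership.Propositional.Properties using (∈-∃++; ∈-++⁻)
open import Data.List.Relation.Unary.All.Properties using (¬Any⇒All¬; All¬⇒¬Any)
open import Data.List.Relation.Unary.All using (All; []; _∷_) renaming (lookup to lookupAll; map to mapAll; tabulate to tabulateAll)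
open import Data.List.Relation.Unary.AllPairs using ([]; _∷_)
open import Data.List.Relation.Unary.Any using (here; there)
open import Data.List.Relation.Unary.Linked using (Linked; [-]) renaming (_∷_ to _∷L_)
open import Data.List.Relation.Unary.Unique.Propositional using (Unique)
open import Data.List.Relation.Unary.Unique.Propositional.Properties using () renaming (++⁺ to Unique-++⁺)
open import Data.Nat using (ℕ; zero; suc; _+_; _*_; _∸_; _≤_; _<_; z≤n; s≤s; _<ᵇ_)
open import Data.Nat.Properties
  using (+-identityʳ; +-comm; +-suc; +-mono-≤; +-mono-<-≤; +-mono-≤-<; +-∸-assoc; m∸n+n≡m; m≤n+m; n≤1+n; n<1+n;
         ≤-refl; ≤-reflexive; ≤-trans; ≤-pred; <⇒≱; *-cancelˡ-≤; *-cancelˡ-<; suc-injective; +-commutativeSemigroup)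
open import Algebra.Properties.CommutativeSemigroup +-commutativeSemigroup using (interchange)
open import Data.Product using (Σ; _×_; _,_; proj₁; proj₂)
open import Data.Sum using (_⊎_; inj₁; inj₂)
open import Data.Unit using (tt)
open import Function using (_∘_; id; case_of_)
open import Function.Bundles using (Equivalence)
open import Relation.Binary.Construct.Closure.ReflexiveTransitive using (Star; ε; _◅_; _◅◅_; reverse) renaming (map to mapStar)
open import Relation.Binary.Construct.Closure.Transitive using (TransClosure; [_]; _∷_; _∷ʳ_) renaming (_++_ to _++⁺_)
open import Relation.Binary.PropositionalEquality hiding (sym)
open import Relation.Binary.PropositionalEquality using () renaming (sym to ≡sym)
open import Relation.Nullary using (¬_; Dec; yes; no; ¬?; _×-dec_)
open import Relation.Nullary.Decidable using (⌊_⌋; toWitness; fromWitness; toWitnessFalse; fromWitnessFalse; ¬¬-excluded-middle)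

open Equivalence using (to; from)


indicator : Bool → ℕ
indicator true = 1
indicator false = 0

∑ : ∀ {n} → (Fin n → ℕ) → ℕ
∑ {zero} f = 0
∑ {suc n} f = f zero + ∑ (f ∘ suc)

∑-cong : ∀ {n} {f g : Fin n → ℕ} → (∀ i → f i ≡ g i) → ∑ f ≡ ∑ g
∑-cong {zero} h = refl
∑-cong {suc n} h = cong₂ _+_ (h zero) (∑-cong (h ∘ suc))

∑-+ : ∀ {n} (f g : Fin n → ℕ) → ∑ (λ i → f i + g i) ≡ ∑ f + ∑ g
∑-+ {zero} f g = refl
∑-+ {suc n} f g = trans (cong (f zero + g zero +_) (∑-+ (f ∘ suc) (g ∘ suc)))
                        (interchange (f zero) (g zero) (∑ (f ∘ suc)) (∑ (g ∘ suc)))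

∑-zero : ∀ {n} (f : Fin n → ℕ) → (∀ i → f i ≡ 0) → ∑ f ≡ 0
∑-zero {zero} f h = refl
∑-zero {suc n} f h = cong₂ _+_ (h zero) (∑-zero (f ∘ suc) (h ∘ suc))

∑-single : ∀ {n} (f : Fin n → ℕ) (k : Fin n) → (∀ i → i ≢ k → f i ≡ 0) → ∑ f ≡ f k
∑-single {suc n} f zero h =
  trans (cong (f zero +_) (∑-zero (f ∘ suc) (λ i → h (suc i) (λ ())))) (+-identityʳ (f zero))
∑-single {suc n} f (suc k) h =
  trans (cong (_+ ∑ (f ∘ suc)) (h zero (λ ())))
        (∑-single (f ∘ suc) k (λ i i≢k → h (suc i) (i≢k ∘ Fin-suc-injective)))

∑-comm : ∀ {m n} (f : Fin m → Fin n → ℕ) → ∑ (λ i → ∑ (λ j → f i j)) ≡ ∑ (λ j → ∑ (λ i → f i j))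
∑-comm {zero} {n} f = ≡sym (∑-zero {n} (λ j → 0) (λ _ → refl))
∑-comm {suc m} {n} f =
  trans (cong (∑ (f zero) +_) (∑-comm (f ∘ suc))) (≡sym (∑-+ (f zero) (λ j → ∑ (λ i → f (suc i) j))))

∑-mono : ∀ {n} {f g : Fin n → ℕ} → (∀ i → f i ≤ g i) → ∑ f ≤ ∑ g
∑-mono {zero} h = z≤n
∑-mono {suc n} h = +-mono-≤ (h zero) (∑-mono (h ∘ suc))

∑-strict : ∀ {n} {f g : Fin n → ℕ} → (∀ i → f i ≤ g i) → (k : Fin n) → f k < g k → ∑ f < ∑ g
∑-strict {suc n} h zero lt = +-mono-<-≤ lt (∑-mono (h ∘ suc))
∑-strict {suc n} h (suc k) lt = +-mono-≤-< (h zero) (∑-strict (h ∘ suc) k lt)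

length-filter-product : ∀ {A B : Set} {m k} (p : A × B → Bool) (f : Fin m → A) (g : Fin k → B) →
  length (filterᵇ p (cartesianProduct (tabulate f) (tabulate g))) ≡ ∑ (λ i → ∑ (λ j → indicator (p (f i , g j))))
length-filter-product {m = zero} p f g = refl
length-filter-product {A} {B} {suc m} p f g = begin
  length (filterᵇ p (row ++ rest))
    ≡⟨ cong length (filter-++ (T? ∘ p) row rest) ⟩
  length (filterᵇ p row ++ filterᵇ p rest)
    ≡⟨ length-++ (filterᵇ p row) ⟩
  length (filterᵇ p row) + length (filterᵇ p rest)
    ≡⟨ cong₂ _+_ (length-filter-row g) (length-filter-product p (f ∘ suc) g) ⟩
  _ ∎
  where
  open ≡-Reasoning
  row rest : List (A × B)
  row = map (f zero ,_) (tabulate g)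
  rest = cartesianProduct (tabulate (f ∘ suc)) (tabulate g)
  length-filter-row : ∀ {k} (g : Fin k → B) →
    length (filterᵇ p (map (f zero ,_) (tabulate g))) ≡ ∑ (λ j → indicator (p (f zero , g j)))
  length-filter-row {zero} g = refl
  length-filter-row {suc k} g with p (f zero , g zero)
  ... | true = cong suc (length-filter-row (g ∘ suc))
  ... | false = length-filter-row (g ∘ suc)

<ᵇ-trichotomy : ∀ m k → m ≢ k → indicator (m <ᵇ k) + indicator (k <ᵇ m) ≡ 1
<ᵇ-trichotomy zero zero m≢k = ⊥-elim (m≢k refl)
<ᵇ-trichotomy zero (suc k) m≢k = refl
<ᵇ-trichotomy (suc m) zero m≢k = refl
<ᵇ-trichotomy (suc m) (suc k) m≢k = <ᵇ-trichotomy m k (m≢k ∘ cong suc)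

¬T⇒false : ∀ {b} → ¬ T b → b ≡ false
¬T⇒false {true} h = ⊥-elim (h tt)
¬T⇒false {false} _ = refl

T-ext : ∀ {a b} → (T a → T b) → (T b → T a) → a ≡ b
T-ext {true} {true} _ _ = refl
T-ext {true} {false} f _ = ⊥-elim (f tt)
T-ext {false} {true} _ g = ⊥-elim (g tt)
T-ext {false} {false} _ _ = refl

module Basics {n} {G : Graph n} where

  adj-irrefl : ∀ {u v} → Adj G u v → u ≢ v
  adj-irrefl {u} a refl = subst T (irrefl G u) a

  adj-sym : ∀ {u v} → Adj G u v → Adj G v u
  adj-sym {u} {v} = subst T (sym G u v)

  matched-sym : (N : Matching G) → ∀ {u v} → InM N u v → InM N v u
  matched-sym N {u} {v} = subst T (msym N u v)

  covered? : (N : Matching G) → ∀ u → Dec (Covered N u)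
  covered? N u = any? (λ v → T? (mat N u v))

  coveredCount : Matching G → ℕ
  coveredCount N = ∑ (λ u → indicator ⌊ covered? N u ⌋)

  -- Every vertex is covered by at most one edge, so the row sums of N are the
  -- covered indicators; counting each edge from both ends gives 2·|N|.
  twice-size : (N : Matching G) → 2 * size N ≡ coveredCount N
  twice-size N = begin
    2 * size N                           ≡⟨ cong (2 *_) size≡S ⟩
    S + (S + 0)                          ≡⟨ cong (S +_) (trans (+-identityʳ S) (≡sym S≡S')) ⟩
    S + S'                               ≡⟨ ≡sym (∑-+ {n} _ _) ⟩
    ∑ (λ u → ∑ (below u) + ∑ (above u))  ≡⟨ ∑-cong {n} (λ u → ≡sym (∑-+ {n} (below u) (above u))) ⟩
    ∑ (λ u → ∑ (λ v → below u v + above u v)) ≡⟨ ∑-cong {n} (λ u → ∑-cong {n} (λ v → ≡sym (split u v))) ⟩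
    ∑ (λ u → ∑ (λ v → indicator (mat N u v))) ≡⟨ ∑-cong row-sum ⟩
    coveredCount N ∎
    where
    open ≡-Reasoning
    below above : Fin n → Fin n → ℕ
    below u v = indicator (mat N u v ∧ (toℕ u <ᵇ toℕ v))
    above u v = indicator (mat N u v ∧ (toℕ v <ᵇ toℕ u))
    S S' : ℕ
    S = ∑ (λ u → ∑ (below u))
    S' = ∑ (λ u → ∑ (above u))
    size≡S : size N ≡ S
    size≡S = length-filter-product (λ { (u , v) → mat N u v ∧ (toℕ u <ᵇ toℕ v) }) id id
    S≡S' : S' ≡ S
    S≡S' = trans (∑-cong {n} (λ u → ∑-cong {n} (λ v → cong (λ b → indicator (b ∧ (toℕ v <ᵇ toℕ u))) (msym N u v))))
                 (∑-comm (λ u v → below v u))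
    split : ∀ u v → indicator (mat N u v) ≡ below u v + above u v
    split u v with mat N u v in eq
    ... | false = refl
    ... | true = ≡sym (<ᵇ-trichotomy (toℕ u) (toℕ v) (λ e → adj-irrefl (sub N u v (subst T (≡sym eq) tt)) (toℕ-injective e)))
    row-sum : ∀ u → ∑ (λ v → indicator (mat N u v)) ≡ indicator ⌊ covered? N u ⌋
    row-sum u with covered? N u
    ... | yes (v , t) = trans (∑-single _ v (λ i i≢v → cong indicator (¬T⇒false (λ ti → i≢v (unique N u i v ti t)))))
                              (cong indicator (to T-≡ t))
    ... | no ¬c = ∑-zero _ (λ i → cong indicator (¬T⇒false (λ ti → ¬c (i , ti))))

  maximum-if-covers-as-many : (N N' : Matching G) → IsMaximum N → coveredCount N ≤ coveredCount N' → IsMaximum N'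
  maximum-if-covers-as-many N N' mx le M' =
    ≤-trans (mx M') (*-cancelˡ-≤ 2 (subst₂ _≤_ (≡sym (twice-size N)) (≡sym (twice-size N')) le))

  maximum-covers-most : (N N' : Matching G) → IsMaximum N → coveredCount N < coveredCount N' → ⊥
  maximum-covers-most N N' mx lt =
    <⇒≱ (*-cancelˡ-< 2 _ _ (subst₂ _<_ (≡sym (twice-size N)) (≡sym (twice-size N')) lt)) (mx N')

  covers-two-more : (N N' : Matching G) (x y : Fin n) → x ≢ y → ¬ Covered N x → ¬ Covered N y →
    (∀ u → Covered N' u → Covered N u ⊎ (u ≡ x ⊎ u ≡ y)) → (∀ u → Covered N u → Covered N' u) →
    Covered N' x → Covered N' y → coveredCount N' ≡ 2 + coveredCount N
  covers-two-more N N' x y x≢y nx ny N'⊆ ⊆N' cx cy = begin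
    coveredCount N'                                         ≡⟨ ∑-cong {n} pointwise ⟩
    ∑ (λ u → indicator ⌊ covered? N u ⌋ + (δ x u + δ y u)) ≡⟨ ∑-+ {n} _ _ ⟩
    coveredCount N + ∑ (λ u → δ x u + δ y u)                ≡⟨ cong (coveredCount N +_) (trans (∑-+ {n} _ _) (cong₂ _+_ (∑δ x) (∑δ y))) ⟩
    coveredCount N + 2                                      ≡⟨ +-comm (coveredCount N) 2 ⟩
    2 + coveredCount N ∎
    where
    open ≡-Reasoning
    δ : Fin n → Fin n → ℕ
    δ x u = indicator ⌊ u ≟ x ⌋
    ∑δ : ∀ x → ∑ (δ x) ≡ 1
    ∑δ x = trans (∑-single (δ x) x (λ i i≢x → cong indicator (¬T⇒false (i≢x ∘ toWitness))))
                 (cong indicator (to T-≡ (fromWitness {a? = x ≟ x} refl)))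
    pointwise : ∀ u → indicator ⌊ covered? N' u ⌋ ≡ indicator ⌊ covered? N u ⌋ + (δ x u + δ y u)
    pointwise u with covered? N' u | covered? N u | u ≟ x | u ≟ y
    ... | _ | _ | yes refl | yes refl = ⊥-elim (x≢y refl)
    ... | yes _ | yes c | yes refl | no _ = ⊥-elim (nx c)
    ... | yes _ | yes c | no _ | yes refl = ⊥-elim (ny c)
    ... | yes _ | yes _ | no _ | no _ = refl
    ... | yes _ | no _ | yes _ | no _ = refl
    ... | yes _ | no _ | no _ | yes _ = refl
    ... | yes c | no c' | no u≢x | no u≢y with N'⊆ u c
    ...   | inj₁ c'' = ⊥-elim (c' c'')
    ...   | inj₂ (inj₁ e) = ⊥-elim (u≢x e)
    ...   | inj₂ (inj₂ e) = ⊥-elim (u≢y e)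
    pointwise u | no c | _ | yes refl | _ = ⊥-elim (c cx)
    pointwise u | no c | _ | no _ | yes refl = ⊥-elim (c cy)
    pointwise u | no c | yes c' | no _ | no _ = ⊥-elim (c (⊆N' u c'))
    pointwise u | no c | no _ | no _ | no _ = refl

  private
    _≟ᵇ_ : Fin n → Fin n → Bool
    u ≟ᵇ x = ⌊ u ≟ x ⌋

  deleteVertex : Matching G → Fin n → Matching G
  deleteVertex N x = record
    { mat = λ u v → mat N u v ∧ (not (u ≟ᵇ x) ∧ not (v ≟ᵇ x))
    ; sub = λ u v t → sub N u v (proj₁ (to T-∧ t))
    ; msym = λ u v → cong₂ _∧_ (msym N u v) (∧-comm (not (u ≟ᵇ x)) (not (v ≟ᵇ x)))
    ; unique = λ u v w t₁ t₂ → unique N u v w (proj₁ (to T-∧ t₁)) (proj₁ (to T-∧ t₂))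
    }

  deleteVertex⁻ : ∀ N x {u v} → InM (deleteVertex N x) u v → InM N u v × u ≢ x × v ≢ x
  deleteVertex⁻ N x {u} {v} t with to (T-∧ {mat N u v}) t
  ... | t₁ , t₂ with to (T-∧ {not (u ≟ᵇ x)}) t₂
  ... | a , b = t₁ , toWitnessFalse a , toWitnessFalse b

  deleteVertex⁺ : ∀ N x {u v} → InM N u v → u ≢ x → v ≢ x → InM (deleteVertex N x) u v
  deleteVertex⁺ N x {u} {v} t u≢x v≢x =
    from (T-∧ {mat N u v}) (t , from (T-∧ {not (u ≟ᵇ x)}) (fromWitnessFalse u≢x , fromWitnessFalse v≢x))

  deleteVertex-count : ∀ N {y x} → InM N y x → coveredCount N ≡ 2 + coveredCount (deleteVertex N y)
  deleteVertex-count N {y} {x} yx =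
    covers-two-more N' N y x (adj-irrefl (sub N y x yx)) (λ (w , t) → proj₁ (proj₂ (deleteVertex⁻ N y t)) refl)
      (λ (w , t) → let (t' , _ , w≢y) = deleteVertex⁻ N y t in w≢y (unique N x w y t' (matched-sym N yx)))
      still (λ u (w , t) → w , proj₁ (deleteVertex⁻ N y t)) (x , yx) (y , matched-sym N yx)
    where
    N' : Matching G
    N' = deleteVertex N y
    still : ∀ u → Covered N u → Covered N' u ⊎ (u ≡ y ⊎ u ≡ x)
    still u (w , t) = case ((u ≟ y) , (w ≟ y)) of λ
      { (yes u≡y , _) → inj₂ (inj₁ u≡y)
      ; (no _ , yes refl) → inj₂ (inj₂ (unique N y u x (matched-sym N t) yx))
      ; (no u≢y , no w≢y) → inj₁ (w , deleteVertex⁺ N y t u≢y w≢y) }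

  IsEdge : Fin n → Fin n → Fin n → Fin n → Set
  IsEdge x y u v = (u ≡ x × v ≡ y) ⊎ (u ≡ y × v ≡ x)

  private
    withEdge : Matching G → Fin n → Fin n → Fin n → Fin n → Bool
    withEdge N x y u v = mat N u v ∨ ((u ≟ᵇ x ∧ v ≟ᵇ y) ∨ (u ≟ᵇ y ∧ v ≟ᵇ x))

    withEdge⁻ : ∀ N x y {u v} → T (withEdge N x y u v) → InM N u v ⊎ IsEdge x y u v
    withEdge⁻ N x y {u} {v} t with to (T-∨ {mat N u v}) t
    ... | inj₁ m = inj₁ m
    ... | inj₂ t' with to (T-∨ {u ≟ᵇ x ∧ v ≟ᵇ y}) t'
    ...   | inj₁ c = let (a , b) = to (T-∧ {u ≟ᵇ x}) c in inj₂ (inj₁ (toWitness a , toWitness b))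
    ...   | inj₂ c = let (a , b) = to (T-∧ {u ≟ᵇ y}) c in inj₂ (inj₂ (toWitness a , toWitness b))

  addEdge : (N : Matching G) (x y : Fin n) → Adj G x y → ¬ Covered N x → ¬ Covered N y → Matching G
  addEdge N x y xy nx ny = record
    { mat = withEdge N x y
    ; sub = edge
    ; msym = λ u v → cong₂ _∨_ (msym N u v)
        (trans (∨-comm (u ≟ᵇ x ∧ v ≟ᵇ y) (u ≟ᵇ y ∧ v ≟ᵇ x)) (cong₂ _∨_ (∧-comm (u ≟ᵇ y) (v ≟ᵇ x)) (∧-comm (u ≟ᵇ x) (v ≟ᵇ y))))
    ; unique = uniq
    }
    where
    edge : ∀ u v → T (withEdge N x y u v) → Adj G u v
    edge u v t with withEdge⁻ N x y t
    ... | inj₁ m = sub N u v m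
    ... | inj₂ (inj₁ (refl , refl)) = xy
    ... | inj₂ (inj₂ (refl , refl)) = adj-sym xy
    uniq : ∀ u v w → T (withEdge N x y u v) → T (withEdge N x y u w) → v ≡ w
    uniq u v w t₁ t₂ with withEdge⁻ N x y t₁ | withEdge⁻ N x y t₂
    ... | inj₁ a | inj₁ b = unique N u v w a b
    ... | inj₁ a | inj₂ (inj₁ (refl , refl)) = ⊥-elim (nx (v , a))
    ... | inj₁ a | inj₂ (inj₂ (refl , refl)) = ⊥-elim (ny (v , a))
    ... | inj₂ (inj₁ (refl , refl)) | inj₁ b = ⊥-elim (nx (w , b))
    ... | inj₂ (inj₂ (refl , refl)) | inj₁ b = ⊥-elim (ny (w , b))
    ... | inj₂ (inj₁ (refl , refl)) | inj₂ (inj₁ (_ , refl)) = refl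
    ... | inj₂ (inj₂ (refl , refl)) | inj₂ (inj₂ (_ , refl)) = refl
    ... | inj₂ (inj₁ (refl , refl)) | inj₂ (inj₂ (e , refl)) = ⊥-elim (adj-irrefl xy e)
    ... | inj₂ (inj₂ (refl , refl)) | inj₂ (inj₁ (e , refl)) = ⊥-elim (adj-irrefl xy (≡sym e))

  module AddEdge (N : Matching G) (x y : Fin n) (xy : Adj G x y) (nx : ¬ Covered N x) (ny : ¬ Covered N y) where

    addEdge⁻ : ∀ {u v} → InM (addEdge N x y xy nx ny) u v → InM N u v ⊎ IsEdge x y u v
    addEdge⁻ = withEdge⁻ N x y

    addEdge⁺ : ∀ {u v} → InM N u v → InM (addEdge N x y xy nx ny) u v
    addEdge⁺ t = from T-∨ (inj₁ t)

    addEdge-new : InM (addEdge N x y xy nx ny) x y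
    addEdge-new = from (T-∨ {mat N x y}) (inj₂ (from (T-∨ {x ≟ᵇ x ∧ y ≟ᵇ y})
                    (inj₁ (from (T-∧ {x ≟ᵇ x}) (fromWitness refl , fromWitness refl)))))

    addEdge-count : coveredCount (addEdge N x y xy nx ny) ≡ 2 + coveredCount N
    addEdge-count = covers-two-more N N' x y (adj-irrefl xy) nx ny new
      (λ u (w , t) → w , addEdge⁺ t) (y , addEdge-new) (x , matched-sym N' addEdge-new)
      where
      N' : Matching G
      N' = addEdge N x y xy nx ny
      new : ∀ u → Covered N' u → Covered N u ⊎ (u ≡ x ⊎ u ≡ y)
      new u (w , t) with addEdge⁻ t
      ... | inj₁ t' = inj₁ (w , t')
      ... | inj₂ (inj₁ (e , _)) = inj₂ (inj₁ e)
      ... | inj₂ (inj₂ (e , _)) = inj₂ (inj₂ e)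

vertices : ∀ {n} {R : Fin n → Fin n → Set} {x y} → Star R x y → List (Fin n)
vertices {x = x} ε = x ∷ []
vertices {x = x} (_ ◅ p) = x ∷ vertices p

module Walks {n : ℕ} {R : Fin n → Fin n → Set} where
  open import Data.List.Membership.DecPropositional {A = Fin n} _≟_ using (_∈?_)

  first∈ : ∀ {x y} (p : Star R x y) → x ∈ vertices p
  first∈ ε = here refl
  first∈ (_ ◅ p) = here refl

  last∈ : ∀ {x y} (p : Star R x y) → y ∈ vertices p
  last∈ ε = here refl
  last∈ (_ ◅ p) = there (last∈ p)

  suffixFrom : ∀ {x y z} (q : Star R y z) → x ∈ vertices q → Unique (vertices q) →
    Σ (Star R x z) λ q' → Unique (vertices q') × (∀ {v} → v ∈ vertices q' → v ∈ vertices q)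
  suffixFrom ε (here refl) u = ε , u , id
  suffixFrom (r ◅ q) (here refl) u = r ◅ q , u , id
  suffixFrom (r ◅ q) (there m) (_ ∷ u) with suffixFrom q m u
  ... | q' , u' , sub' = q' , u' , there ∘ sub'

  PathIn : ∀ {x y} → Star R x y → Set
  PathIn {x} {y} p = Σ (Star R x y) λ q → Unique (vertices q) × (∀ {v} → v ∈ vertices q → v ∈ vertices p)

  simplify : ∀ {x y} (p : Star R x y) → PathIn p
  simplify ε = ε , [] ∷ [] , id
  simplify {x} (r ◅ p) with simplify p
  ... | q , uq , q⊆p with x ∈? vertices q
  ...   | yes m = let (q' , u' , q'⊆q) = suffixFrom q m uq in q' , u' , there ∘ q⊆p ∘ q'⊆q
  ...   | no x∉q = r ◅ q , ¬Any⇒All¬ (vertices q) x∉q ∷ uq , λ { (here e) → here e ; (there m) → there (q⊆p m) }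

  arc-into : ∀ {x z} (p : Star R x z) → Unique (vertices p) → ∀ {v} → v ∈ vertices p → v ≢ x →
    Σ (Fin n) λ u → R u v × u ∈ vertices p × u ≢ z
  arc-into ε _ (here refl) v≢x = ⊥-elim (v≢x refl)
  arc-into (_ ◅ p) _ (here refl) v≢x = ⊥-elim (v≢x refl)
  arc-into {x} (_◅_ {j = y} r p) (x∉p ∷ u) {v} (there m) v≢x with v ≟ y
  ... | yes refl = x , r , here refl , λ e → All¬⇒¬Any x∉p (subst (_∈ vertices p) (≡sym e) (last∈ p))
  ... | no v≢y = let (w , rw , mw , w≢z) = arc-into p u m v≢y in w , rw , there mw , w≢z

  arc-out-of : ∀ {x z} (p : Star R x z) → ∀ {v} → v ∈ vertices p → v ≢ z → Σ (Fin n) λ w → R v w × w ∈ vertices p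
  arc-out-of ε (here refl) v≢z = ⊥-elim (v≢z refl)
  arc-out-of (_◅_ {j = y} r p) (here refl) _ = y , r , there (first∈ p)
  arc-out-of (_ ◅ p) (there m) v≢z = let (w , r , mw) = arc-out-of p m v≢z in w , r , there mw

  unsnoc : ∀ {x y} (p : Star R x y) → x ≡ y ⊎ Σ (Fin n) λ w → Star R x w × R w y
  unsnoc ε = inj₁ refl
  unsnoc (r ◅ p) with unsnoc p
  ... | inj₁ refl = inj₂ (_ , ε , r)
  ... | inj₂ (w , q , r') = inj₂ (w , r ◅ q , r')

  _▷_ : ∀ {x y z} → Star R x y → R y z → Star R x z
  p ▷ r = p ◅◅ (r ◅ ε)

  vertices-▷ : ∀ {x y z} (p : Star R x y) (r : R y z) → vertices (p ▷ r) ≡ vertices p ++ (z ∷ [])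
  vertices-▷ ε r = refl
  vertices-▷ (r' ◅ p) r = cong (_ ∷_) (vertices-▷ p r)

  split-at : ∀ {x y} (p : Star R x y) → ∀ {v} → v ∈ vertices p → Star R x v × Star R v y
  split-at ε (here refl) = ε , ε
  split-at (r ◅ p) (here refl) = ε , r ◅ p
  split-at (r ◅ p) (there m) = let (p₁ , p₂) = split-at p m in r ◅ p₁ , p₂

  _◅⁺_ : ∀ {x y z} → R x y → Star R y z → TransClosure R x z
  r ◅⁺ ε = [ r ]
  r ◅⁺ (r' ◅ p) = r ∷ (r' ◅⁺ p)

  nonempty : ∀ {x y} → Star R x y → x ≢ y → TransClosure R x y
  nonempty ε x≢y = ⊥-elim (x≢y refl)
  nonempty (r ◅ p) _ = r ◅⁺ p

  uncons⁺ : ∀ {x y} → TransClosure R x y → Σ (Fin n) λ m → R x m × Star R m y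
  uncons⁺ [ r ] = _ , r , ε
  uncons⁺ (r ∷ t) = let (m , r' , p) = uncons⁺ t in _ , r , r' ◅ p

  ⁺⇒* : ∀ {x y} → TransClosure R x y → Star R x y
  ⁺⇒* t = let (_ , r , p) = uncons⁺ t in r ◅ p

  map-in-context : ∀ {R' : Fin n → Fin n → Set} {x y} (p : Star R x y) →
    (∀ {u v} → Star R x u → R u v → Star R v y → R' u v) → Star R' x y
  map-in-context ε f = ε
  map-in-context (r ◅ p) f = f ε r p ◅ map-in-context p (λ pre r' post → f (r ◅ pre) r' post)

  1≤length-vertices : ∀ {x y} (p : Star R x y) → 1 ≤ length (vertices p)
  1≤length-vertices ε = s≤s z≤n
  1≤length-vertices (_ ◅ _) = s≤s z≤n

  vertices-linked : ∀ {S : Fin n → Fin n → Set} → (∀ {u v} → R u v → S u v) →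
    ∀ {x w y} (p : Star R x w) → S w y → Linked S (vertices p ++ y ∷ [])
  vertices-linked f ε s = s ∷L [-]
  vertices-linked f (r ◅ ε) s = f r ∷L (s ∷L [-])
  vertices-linked f (r ◅ (r' ◅ p)) s = f r ∷L vertices-linked f (r' ◅ p) s

  relabel : ∀ {R' : Fin n → Fin n → Set} {x z} (p : Star R x z) → Unique (vertices p) →
    (∀ {u v} → R u v → u ∈ vertices p → v ∈ vertices p → u ≢ z → v ≢ x → R' u v) →
    Σ (Star R' x z) λ p' → vertices p' ≡ vertices p
  relabel ε _ f = ε , refl
  relabel {x = x} {z} (_◅_ {j = y} r p) (x∉p ∷ u) f =
    let (p' , e) = relabel p u (λ r' mu mv u≢z v≢y → f r' (there mu) (there mv) u≢z (λ e → ∉p (subst (_∈ vertices p) e mv)))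
    in f r (here refl) (there (first∈ p)) (λ e → ∉p (subst (_∈ vertices p) (≡sym e) (last∈ p))) (λ e → ∉p (subst (_∈ vertices p) e (first∈ p))) ◅ p'
       , cong (x ∷_) e
    where
    ∉p : x ∉ vertices p
    ∉p = All¬⇒¬Any x∉p

  first-entry : (L : List (Fin n)) → ∀ {x y} → Star R x y → y ∈ L →
    Σ (Fin n) λ v → v ∈ L × (Σ (Star R x v) λ q → ∀ {u} → u ∈ vertices q → u ∈ L → u ≡ v) × Star R v y
  first-entry L {x} p y∈L with x ∈? L
  ... | yes x∈L = x , x∈L , (ε , λ { (here e) _ → e }) , p
  first-entry L {x} ε y∈L | no x∉L = ⊥-elim (x∉L y∈L)
  first-entry L {x} (r ◅ p) y∈L | no x∉L =
    let (v , v∈L , (q , first) , s) = first-entry L p y∈L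
    in v , v∈L , (r ◅ q , λ { (here refl) x∈L → ⊥-elim (x∉L x∈L) ; (there m) u∈L → first m u∈L }) , s

⁺-map : ∀ {n} {R R' : Fin n → Fin n → Set} → (∀ {x y} → R x y → R' x y) → ∀ {x y} → TransClosure R x y → TransClosure R' x y
⁺-map f [ r ] = [ f r ]
⁺-map f (r ∷ t) = f r ∷ ⁺-map f t

⁺-reverse-concat : ∀ {n} {R : Fin n → Fin n → Set} {x y} → TransClosure (λ a b → TransClosure R b a) x y → TransClosure R y x
⁺-reverse-concat [ t ] = t
⁺-reverse-concat (t ∷ ts) = ⁺-reverse-concat ts ++⁺ t

-- Pigeonhole: if every vertex satisfying P has an R-successor satisfying P,
-- iterating from any such vertex revisits a vertex, giving a closed walk.
module ClosedWalk {n : ℕ} (R : Fin n → Fin n → Set) (P : Fin n → Set)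
                  (step : ∀ x → P x → Σ (Fin n) λ y → R x y × P y) where

  iterate : (x₀ : Fin n) → P x₀ → ℕ → Σ (Fin n) P
  iterate x₀ p₀ zero = x₀ , p₀
  iterate x₀ p₀ (suc k) = let (x , px) = iterate x₀ p₀ k in proj₁ (step x px) , proj₂ (proj₂ (step x px))

  closed-walk : (x₀ : Fin n) → P x₀ → Σ (Fin n) λ z → TransClosure R z z
  closed-walk x₀ p₀ = let (_ , _ , i<j , fi≡fj) = pigeonhole (n<1+n n) (λ i → f (toℕ i)) in from-repeat i<j fi≡fj
    where
    f : ℕ → Fin n
    f k = proj₁ (iterate x₀ p₀ k)
    arc : ∀ k → R (f k) (f (suc k))
    arc k = let (x , px) = iterate x₀ p₀ k in proj₁ (proj₂ (step x px))
    walk : ∀ k d → TransClosure R (f k) (f (suc d + k))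
    walk k zero = [ arc k ]
    walk k (suc d) = walk k d ∷ʳ arc (suc d + k)
    from-repeat : ∀ {i j : ℕ} → i < j → f i ≡ f j → Σ (Fin n) λ z → TransClosure R z z
    from-repeat {i} {j} i<j fi≡fj =
      f i , subst (TransClosure R (f i)) (≡sym fi≡fj) (subst (λ k → TransClosure R (f i) (f k)) index (walk i (j ∸ suc i)))
      where
      index : suc (j ∸ suc i) + i ≡ j
      index = trans (cong (_+ i) (≡sym (+-∸-assoc 1 i<j))) (m∸n+n≡m (≤-trans (n≤1+n i) i<j))

-- Exchanging the N-edge yx for ay, where a is uncovered: the cover changes by
-- x ↦ a only, so the number of covered vertices is unchanged.
module Exchange {n} {G : Graph n} where
  open Basics {n} {G}

  record Swap (N : Matching G) (a y x : Fin n) : Set where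
    field
      matching : Matching G
      swap⁻ : ∀ {u v} → InM matching u v → (InM N u v × u ≢ y × v ≢ y) ⊎ IsEdge a y u v
      kept : ∀ {u v} → InM N u v → u ≢ y → v ≢ y → InM matching u v
      new-edge : InM matching a y
      same-count : coveredCount matching ≡ coveredCount N
      freed : ¬ Covered matching x
      stays-uncovered : ∀ {z} → ¬ Covered N z → z ≢ a → z ≢ y → ¬ Covered matching z
      unchanged : ∀ u → u ≢ a → u ≢ y → u ≢ x → ∀ w → mat matching u w ≡ mat N u w

  swap : (N : Matching G) (a y x : Fin n) → Adj G a y → ¬ Covered N a → InM N y x → Swap N a y x
  swap N a y x ay na yx = record
    { matching = N₁
    ; swap⁻ = swap⁻
    ; kept = kept
    ; new-edge = addEdge-new
    ; same-count = trans addEdge-count (≡sym (deleteVertex-count N yx))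
    ; freed = freed
    ; stays-uncovered = λ nz z≢a z≢y (w , t) → case swap⁻ t of λ
        { (inj₁ (t' , _)) → nz (w , t') ; (inj₂ (inj₁ (e , _))) → z≢a e ; (inj₂ (inj₂ (e , _))) → z≢y e }
    ; unchanged = unchanged
    }
    where
    N₀ : Matching G
    N₀ = deleteVertex N y
    na₀ : ¬ Covered N₀ a
    na₀ (w , t) = na (w , proj₁ (deleteVertex⁻ N y t))
    ny₀ : ¬ Covered N₀ y
    ny₀ (w , t) = proj₁ (proj₂ (deleteVertex⁻ N y t)) refl
    open AddEdge N₀ a y ay na₀ ny₀
    N₁ : Matching G
    N₁ = addEdge N₀ a y ay na₀ ny₀
    swap⁻ : ∀ {u v} → InM N₁ u v → (InM N u v × u ≢ y × v ≢ y) ⊎ IsEdge a y u v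
    swap⁻ t with addEdge⁻ t
    ... | inj₁ t' = inj₁ (deleteVertex⁻ N y t')
    ... | inj₂ e = inj₂ e
    kept : ∀ {u v} → InM N u v → u ≢ y → v ≢ y → InM N₁ u v
    kept t u≢y v≢y = addEdge⁺ (deleteVertex⁺ N y t u≢y v≢y)
    freed : ¬ Covered N₁ x
    freed (w , t) with swap⁻ t
    ... | inj₁ (t' , _ , w≢y) = w≢y (unique N x w y t' (matched-sym N yx))
    ... | inj₂ (inj₁ (x≡a , _)) = na (y , subst (λ z → InM N z y) x≡a (matched-sym N yx))
    ... | inj₂ (inj₂ (x≡y , _)) = adj-irrefl (sub N y x yx) (≡sym x≡y)
    unchanged : ∀ u → u ≢ a → u ≢ y → u ≢ x → ∀ w → mat N₁ u w ≡ mat N u w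
    unchanged u u≢a u≢y u≢x w = T-ext old new
      where
      old : InM N₁ u w → InM N u w
      old t with swap⁻ t
      ... | inj₁ (t' , _) = t'
      ... | inj₂ (inj₁ (u≡a , _)) = ⊥-elim (u≢a u≡a)
      ... | inj₂ (inj₂ (u≡y , _)) = ⊥-elim (u≢y u≡y)
      new : InM N u w → InM N₁ u w
      new t = kept t u≢y (λ w≡y → u≢x (unique N y u x (matched-sym N (subst (InM N u) w≡y t)) yx))

module Alternating {n} (G : Graph n) (side : Side n) (bip : IsBipartite G side) where
  open Basics {n} {G}
  open Exchange {n} {G}
  open Walks

  not-both : ∀ {x} → InA side x → InB side x → ⊥
  not-both a b with trans (≡sym a) b
  ... | ()

  ¬A⇒B : ∀ {x} → ¬ InA side x → InB side x
  ¬A⇒B {x} h with side x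
  ... | true = ⊥-elim (h refl)
  ... | false = refl

  ¬B⇒A : ∀ {x} → ¬ InB side x → InA side x
  ¬B⇒A {x} h with side x
  ... | true = refl
  ... | false = ⊥-elim (h refl)

  A? : ∀ x → Dec (InA side x)
  A? x = side x Data.Bool.≟ true

  A-nbr-is-B : ∀ {x y} → Adj G x y → InA side x → InB side y
  A-nbr-is-B xy a = ¬A⇒B (λ a' → bip _ _ xy (trans a (≡sym a')))

  B-nbr-is-A : ∀ {x y} → Adj G x y → InB side x → InA side y
  B-nbr-is-A xy b = ¬B⇒A (λ b' → bip _ _ xy (trans b (≡sym b')))

  D : Matching G → Fin n → Fin n → Set
  D N = Arc G side N

  arc-from-A : ∀ {N x y} → InA side x → D N x y → InB side y × Adj G x y × ¬ InM N x y
  arc-from-A a (inj₁ (_ , b , xy , ¬m)) = b , xy , ¬m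
  arc-from-A a (inj₂ (b , _ , _)) = ⊥-elim (not-both a b)

  arc-from-B : ∀ {N x y} → InB side x → D N x y → InA side y × InM N x y
  arc-from-B b (inj₁ (a , _ , _)) = ⊥-elim (not-both a b)
  arc-from-B b (inj₂ (_ , a , m)) = a , m

  arc-adj : ∀ {N x y} → D N x y → Adj G x y
  arc-adj (inj₁ (_ , _ , xy , _)) = xy
  arc-adj {N} {x} {y} (inj₂ (_ , _ , m)) = sub N x y m

  no-loop : ∀ {N y} → D N y y → ⊥
  no-loop {N} r = adj-irrefl (arc-adj {N} r) refl

  no-2-cycle : ∀ {N x y} → D N x y → D N y x → ⊥
  no-2-cycle {N} {x} r₁ r₂ with A? x
  ... | yes a = proj₂ (proj₂ (arc-from-A {N} a r₁)) (matched-sym N (proj₂ (arc-from-B {N} (proj₁ (arc-from-A {N} a r₁)) r₂)))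
  ... | no ¬a = proj₂ (proj₂ (arc-from-A {N} (proj₁ (arc-from-B {N} (¬A⇒B ¬a) r₁)) r₂)) (matched-sym N (proj₂ (arc-from-B {N} (¬A⇒B ¬a) r₁)))

  -- Only the edges at a and y change in a swap, so the other arcs survive.
  swap-arc : ∀ {N a y x} (sw : Swap N a y x) {u v} → D N u v → u ≢ a → u ≢ y → v ≢ y → D (Swap.matching sw) u v
  swap-arc sw (inj₁ (a , b , uv , ¬m)) u≢a u≢y _ = inj₁ (a , b , uv , λ t → case Swap.swap⁻ sw t of λ
    { (inj₁ (t' , _)) → ¬m t' ; (inj₂ (inj₁ (e , _))) → u≢a e ; (inj₂ (inj₂ (e , _))) → u≢y e })
  swap-arc sw (inj₂ (b , a , m)) _ u≢y v≢y = inj₂ (b , a , Swap.kept sw m u≢y v≢y)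

  -- The result of shifting N along a path p from an uncovered A-vertex a₀ to z:
  -- the arcs a→b of p become N-edges and the arcs b→a stop being N-edges.
  -- (Q ⊆ D(N) along p; recording Q lets callers remember which arcs were used.)
  record Shift (N : Matching G) (Q : Fin n → Fin n → Set) {a₀ z : Fin n} (p : Star Q a₀ z) : Set where
    field
      result : Matching G
      off-path : ∀ u → u ∉ vertices p → ∀ w → mat result u w ≡ mat N u w
      on-path : ∀ u → u ∈ vertices p → (Σ (Fin n) λ w → InM result u w × (Q u w ⊎ Q w u)) ⊎ (u ≡ z × InA side z)
      end-free : InA side z → ¬ Covered result z
      count-same : InA side z → coveredCount result ≡ coveredCount N
      count-more : ¬ InA side z → coveredCount result ≡ 2 + coveredCount N

  -- Shifting along a path of D(N) that starts at an uncovered A-vertex and ends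
  -- in A or at an uncovered vertex.  By induction: swap the first two arcs.
  shift : (N : Matching G) {Q : Fin n → Fin n → Set} {a₀ z : Fin n} (p : Star Q a₀ z) → Unique (vertices p) →
    (∀ {u v} → Q u v → u ∈ vertices p → v ∈ vertices p → u ≢ z → v ≢ a₀ → D N u v) →
    InA side a₀ → ¬ Covered N a₀ → (InA side z ⊎ ¬ Covered N z) → Shift N Q p
  shift N ε _ _ a₀A na₀ _ = record
    { result = N ; off-path = λ _ _ _ → refl ; on-path = λ { u (here e) → inj₂ (e , a₀A) } ; end-free = λ _ → na₀
    ; count-same = λ _ → refl ; count-more = λ h → ⊥-elim (h a₀A) }
  shift N {Q} {a₀} (_◅_ {j = y} r₁ ε) ((a₀∉ ∷ _) ∷ _) arcs a₀A na₀ end = record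
    { result = N₁ ; off-path = off-path ; on-path = on-path
    ; end-free = λ h → ⊥-elim (not-both h yB) ; count-same = λ h → ⊥-elim (not-both h yB) ; count-more = λ _ → addEdge-count }
    where
    r : D N a₀ y
    r = arcs r₁ (here refl) (there (here refl)) a₀∉ (a₀∉ ∘ ≡sym)
    yB : InB side y
    yB = proj₁ (arc-from-A {N} a₀A r)
    ny : ¬ Covered N y
    ny = case end of λ { (inj₁ a) → ⊥-elim (not-both a yB) ; (inj₂ c) → c }
    a₀y : Adj G a₀ y
    a₀y = proj₁ (proj₂ (arc-from-A {N} a₀A r))
    open AddEdge N a₀ y a₀y na₀ ny
    N₁ : Matching G
    N₁ = addEdge N a₀ y a₀y na₀ ny
    off-path : ∀ u → u ∉ a₀ ∷ y ∷ [] → ∀ w → mat N₁ u w ≡ mat N u w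
    off-path u u∉ w = T-ext (λ t → case addEdge⁻ t of λ
                               { (inj₁ t') → t'
                               ; (inj₂ (inj₁ (e , _))) → ⊥-elim (u∉ (here e))
                               ; (inj₂ (inj₂ (e , _))) → ⊥-elim (u∉ (there (here e))) })
                            addEdge⁺
    on-path : ∀ u → u ∈ a₀ ∷ y ∷ [] → (Σ (Fin n) λ w → InM N₁ u w × (Q u w ⊎ Q w u)) ⊎ (u ≡ y × InA side y)
    on-path u (here refl) = inj₁ (y , addEdge-new , inj₁ r₁)
    on-path u (there (here refl)) = inj₁ (a₀ , matched-sym N₁ addEdge-new , inj₂ r₁)
  shift N {Q} {a₀} {z} (_◅_ {j = y} r₁ (_◅_ {j = x} r₂ p)) (a₀∉ ∷ (y∉ ∷ uq)) arcs a₀A na₀ end = record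
    { result = Shift.result rest ; off-path = off-path ; on-path = on-path ; end-free = Shift.end-free rest
    ; count-same = λ h → trans (Shift.count-same rest h) (Swap.same-count sw)
    ; count-more = λ h → trans (Shift.count-more rest h) (cong (2 +_) (Swap.same-count sw)) }
    where
    a₀∉p : a₀ ∉ y ∷ vertices p
    a₀∉p = All¬⇒¬Any a₀∉
    y∉p : y ∉ vertices p
    y∉p = All¬⇒¬Any y∉
    a₀∉p' : ∀ {u} → u ∈ vertices p → u ≢ a₀
    a₀∉p' m e = a₀∉p (there (subst (_∈ vertices p) e m))
    y∉p' : ∀ {u} → u ∈ vertices p → u ≢ y
    y∉p' m e = y∉p (subst (_∈ vertices p) e m)
    ay : D N a₀ y
    ay = arcs r₁ (here refl) (there (here refl)) (a₀∉p' (last∈ p) ∘ ≡sym) (λ e → a₀∉p (here (≡sym e)))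
    yB : InB side y
    yB = proj₁ (arc-from-A {N} a₀A ay)
    yx : D N y x
    yx = arcs r₂ (there (here refl)) (there (there (first∈ p))) (y∉p' (last∈ p) ∘ ≡sym) (a₀∉p' (first∈ p))
    xA : InA side x
    xA = proj₁ (arc-from-B {N} yB yx)
    sw : Swap N a₀ y x
    sw = swap N a₀ y x (proj₁ (proj₂ (arc-from-A {N} a₀A ay))) na₀ (proj₂ (arc-from-B {N} yB yx))
    N₁ : Matching G
    N₁ = Swap.matching sw
    arcs' : ∀ {u v} → Q u v → u ∈ vertices p → v ∈ vertices p → u ≢ z → v ≢ x → D N₁ u v
    arcs' q mu mv u≢z v≢x =
      swap-arc sw (arcs q (there (there mu)) (there (there mv)) u≢z (a₀∉p' mv)) (a₀∉p' mu) (y∉p' mu) (y∉p' mv)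
    end' : InA side z ⊎ ¬ Covered N₁ z
    end' = case end of λ
      { (inj₁ zA) → inj₁ zA
      ; (inj₂ nz) → inj₂ (Swap.stays-uncovered sw nz (a₀∉p' (last∈ p)) (y∉p' (last∈ p))) }
    rest : Shift N₁ Q p
    rest = shift N₁ p uq arcs' xA (Swap.freed sw) end'
    result : Matching G
    result = Shift.result rest
    off-path : ∀ u → u ∉ a₀ ∷ y ∷ vertices p → ∀ w → mat result u w ≡ mat N u w
    off-path u u∉ w = trans (Shift.off-path rest u (u∉ ∘ there ∘ there) w)
      (Swap.unchanged sw u (u∉ ∘ here) (u∉ ∘ there ∘ here) (λ e → u∉ (there (there (subst (_∈ vertices p) (≡sym e) (first∈ p))))) w)
    a₀y : InM result a₀ y
    a₀y = subst T (≡sym (Shift.off-path rest a₀ (a₀∉p ∘ there) y)) (Swap.new-edge sw)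
    on-path : ∀ u → u ∈ a₀ ∷ y ∷ vertices p → (Σ (Fin n) λ w → InM result u w × (Q u w ⊎ Q w u)) ⊎ (u ≡ z × InA side z)
    on-path u (here refl) = inj₁ (y , a₀y , inj₁ r₁)
    on-path u (there (here refl)) = inj₁ (a₀ , matched-sym result a₀y , inj₂ r₁)
    on-path u (there (there m)) = Shift.on-path rest u m

  rotate-to-B : ∀ {N z} → TransClosure (D N) z z → Σ (Fin n) λ y → InB side y × TransClosure (D N) y y
  rotate-to-B {N} [ r ] = ⊥-elim (no-loop {N} r)
  rotate-to-B {N} {z} (_∷_ {y = y} r t) with A? z
  ... | yes a = y , proj₁ (arc-from-A {N} a r) , t ∷ʳ r
  ... | no ¬a = z , ¬A⇒B ¬a , r ∷ t

  -- On a path of D(N) from a covered A-vertex x to a covered B-vertex y every vertex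
  -- is covered: other A-vertices are entered, other B-vertices left, along N-edges.
  path-covered : ∀ {N x y} (q : Star (D N) x y) → Unique (vertices q) → Covered N x → Covered N y →
    ∀ {v} → v ∈ vertices q → Covered N v
  path-covered {N} {x} {y} q uq cx cy {v} m with v ≟ x | v ≟ y
  ... | yes refl | _ = cx
  ... | no _ | yes refl = cy
  ... | no v≢x | no v≢y with A? v
  ...   | yes vA = let (u , r , _) = arc-into q uq m v≢x in case A? u of λ
          { (yes uA) → ⊥-elim (not-both vA (proj₁ (arc-from-A {N} uA r)))
          ; (no ¬uA) → u , matched-sym N (proj₂ (arc-from-B {N} (¬A⇒B ¬uA) r)) }
  ...   | no ¬vA = let (w , r , _) = arc-out-of q m v≢y in w , proj₂ (arc-from-B {N} (¬A⇒B ¬vA) r)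

  -- A closed walk of D(N) yields a second matching with the same cover as N.
  -- Rotate it to start with an N-edge y → x; in N minus y, shift along a path x ⇝ y.
  closed-walk⇒not-UR : (N : Matching G) {z : Fin n} → TransClosure (D N) z z →
    Σ (Matching G) λ N' → SameCover N N' × ¬ SameEdges N N'
  closed-walk⇒not-UR N t₀ with rotate-to-B {N} t₀
  ... | y , yB , [ r ] = ⊥-elim (no-loop {N} r)
  ... | y , yB , (_∷_ {y = x} r t) = Shift.result sh , same-cover , differs
    where
    open import Data.List.Membership.DecPropositional {A = Fin n} _≟_ using (_∈?_)
    xA : InA side x
    xA = proj₁ (arc-from-B {N} yB r)
    yx : InM N y x
    yx = proj₂ (arc-from-B {N} yB r)
    -- arcs other than y → x (the path below never uses it, as it ends at y)
    Q : Fin n → Fin n → Set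
    Q u v = D N u v × ¬ (u ≡ y × v ≡ x)
    simple : PathIn (⁺⇒* t)
    simple = simplify (⁺⇒* t)
    q₀ : Star (D N) x y
    q₀ = proj₁ simple
    relabelled : Σ (Star Q x y) λ q → vertices q ≡ vertices q₀
    relabelled = relabel q₀ (proj₁ (proj₂ simple)) (λ r _ _ u≢y _ → r , λ (e , _) → u≢y e)
    q : Star Q x y
    q = proj₁ relabelled
    q≡q₀ : vertices q ≡ vertices q₀
    q≡q₀ = proj₂ relabelled
    uq : Unique (vertices q)
    uq = subst Unique (≡sym q≡q₀) (proj₁ (proj₂ simple))
    N₀ : Matching G
    N₀ = deleteVertex N y
    arcs : ∀ {u v} → Q u v → u ∈ vertices q → v ∈ vertices q → u ≢ y → v ≢ x → D N₀ u v
    arcs (inj₁ (a , b , uv , ¬m) , _) _ _ _ _ = inj₁ (a , b , uv , λ t → ¬m (proj₁ (deleteVertex⁻ N y t)))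
    arcs (inj₂ (b , a , m) , _) _ _ u≢y _ = inj₂ (b , a , deleteVertex⁺ N y m u≢y (λ e → not-both a (subst (InB side) (≡sym e) yB)))
    nx : ¬ Covered N₀ x
    nx (w , t) = let (t' , _ , w≢y) = deleteVertex⁻ N y t in w≢y (unique N x w y t' (matched-sym N yx))
    ny : ¬ Covered N₀ y
    ny (w , t) = proj₁ (proj₂ (deleteVertex⁻ N y t)) refl
    sh : Shift N₀ Q q
    sh = shift N₀ q uq arcs xA nx (inj₂ ny)
    N' : Matching G
    N' = Shift.result sh
    same-cover : SameCover N N'
    same-cover v with v ∈? vertices q
    ... | yes m = (λ _ → case Shift.on-path sh v m of λ
                    { (inj₁ (w , t , _)) → w , t
                    ; (inj₂ (_ , yA)) → ⊥-elim (not-both yA yB) })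
                , (λ _ → path-covered {N} q₀ (proj₁ (proj₂ simple)) (y , matched-sym N yx) (x , yx) (subst (v ∈_) q≡q₀ m))
    ... | no v∉q = (λ (w , t) → w , subst T (≡sym (Shift.off-path sh v v∉q w))
                     (deleteVertex⁺ N y t (λ e → v∉q (subst (_∈ vertices q) (≡sym e) (last∈ q)))
                       (λ e → v∉q (subst (_∈ vertices q) (≡sym (unique N y v x (matched-sym N (subst (InM N v) e t)) yx)) (first∈ q)))))
                 , (λ (w , t) → w , proj₁ (deleteVertex⁻ N y (subst T (Shift.off-path sh v v∉q w) t)))
    -- x is N'-matched along an arc of q, hence not to y
    differs : ¬ SameEdges N N'
    differs same with Shift.on-path sh x (first∈ q)
    ... | inj₂ (e , _) = not-both xA (subst (InB side) (≡sym e) yB)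
    ... | inj₁ (w , t , arc) with unique N' x w y t (subst T (same x y) (matched-sym N yx))
    ...   | refl = case arc of λ
            { (inj₁ (d , _)) → proj₂ (proj₂ (arc-from-A {N} xA d)) (matched-sym N yx)
            ; (inj₂ (_ , excluded)) → excluded (refl , refl) }

  -- Conversely, a matching N' ≠ N with the same cover yields a closed walk of D(N):
  -- from an A-vertex x with an N'-edge xw ∉ N go to w and back along the N-edge at w
  -- (N covers w as N' does) to an A-vertex x' of the same kind, and repeat.
  same-cover⇒closed-walk : ∀ N N' → SameCover N N' → ¬ SameEdges N N' → Σ (Fin n) λ z → TransClosure (D N) z z
  same-cover⇒closed-walk N N' same-cover differ with any? (λ u → any? (λ v → ¬? (mat N u v Data.Bool.≟ mat N' u v)))
  ... | no ¬diff = ⊥-elim (differ λ u v → case mat N u v Data.Bool.≟ mat N' u v of λ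
        { (yes e) → e ; (no ne) → ⊥-elim (¬diff (u , v , ne)) })
  ... | yes (u , v , ne) =
    let (x , px) = start u v ne ; (z , t) = ClosedWalk.closed-walk TwoSteps P step x px in z , double-steps t
    where
    P : Fin n → Set
    P x = InA side x × Σ (Fin n) λ w → InM N' x w × ¬ InM N x w
    TwoSteps : Fin n → Fin n → Set
    TwoSteps x y = Σ (Fin n) λ m → D N x m × D N m y
    double-steps : ∀ {x y} → TransClosure TwoSteps x y → TransClosure (D N) x y
    double-steps [ (_ , r₁ , r₂) ] = r₁ ∷ [ r₂ ]
    double-steps ((_ , r₁ , r₂) ∷ t) = r₁ ∷ (r₂ ∷ double-steps t)
    step : ∀ x → P x → Σ (Fin n) λ y → TwoSteps x y × P y
    step x (xA , w , xw , ¬Nxw) with proj₂ (same-cover w) (x , matched-sym N' xw)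
    ... | x' , wx' = x' , (w , (inj₁ (xA , wB , sub N' x w xw , ¬Nxw)) , inj₂ (wB , x'A , wx')) , x'A , w' , x'w' , ¬Nx'w'
      where
      wB : InB side w
      wB = A-nbr-is-B (sub N' x w xw) xA
      x'A : InA side x'
      x'A = B-nbr-is-A (sub N w x' wx') wB
      w' : Fin n
      w' = proj₁ (proj₁ (same-cover x') (w , matched-sym N wx'))
      x'w' : InM N' x' w'
      x'w' = proj₂ (proj₁ (same-cover x') (w , matched-sym N wx'))
      -- otherwise w' = w, so x' = x and xw ∈ N
      ¬Nx'w' : ¬ InM N x' w'
      ¬Nx'w' Nx'w' = ¬Nxw (subst (λ k → InM N k w) x'≡x (matched-sym N wx'))
        where
        w'≡w : w' ≡ w
        w'≡w = unique N x' w' w Nx'w' (matched-sym N wx')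
        x'≡x : x' ≡ x
        x'≡x = unique N' w x' x (matched-sym N' (subst (InM N' x') w'≡w x'w')) (matched-sym N' xw)
    from-edge : ∀ {u w} → InM N' u w → ¬ InM N u w → Σ (Fin n) P
    from-edge {u} {w} uw ¬Nuw with A? u
    ... | yes uA = u , uA , w , uw , ¬Nuw
    ... | no ¬uA = w , B-nbr-is-A (sub N' u w uw) (¬A⇒B ¬uA) , u , matched-sym N' uw , ¬Nuw ∘ matched-sym N
    start : ∀ u v → mat N u v ≢ mat N' u v → Σ (Fin n) P
    start u v ne with T? (mat N' u v) | T? (mat N u v)
    ... | yes N'uv | yes Nuv = ⊥-elim (ne (trans (to T-≡ Nuv) (≡sym (to T-≡ N'uv))))
    ... | yes N'uv | no ¬Nuv = from-edge N'uv ¬Nuv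
    ... | no ¬N'uv | no ¬Nuv = ⊥-elim (ne (trans (¬T⇒false ¬Nuv) (≡sym (¬T⇒false ¬N'uv))))
    ... | no ¬N'uv | yes Nuv with proj₁ (same-cover u) (v , Nuv)
    ...   | w , N'uw = from-edge N'uw λ Nuw → ¬N'uv (subst (InM N' u) (unique N u w v Nuw Nuv) N'uw)

  V⁺[_] V⁻[_] : Matching G → Fin n → Set
  V⁺[ N ] = V⁺ G side N
  V⁻[ N ] = V⁻ G side N

  V⁺-step : ∀ {N u v} → V⁺[ N ] u → D N u v → V⁺[ N ] v
  V⁺-step (a₀ , h , p) r = a₀ , h , p ▷ r

  -- A covered A-vertex of V⁺(N) is reached through its N-partner, which is thus in V⁺(N).
  V⁺-partner : ∀ {N w v} → V⁺[ N ] w → InA side w → InM N w v → V⁺[ N ] v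
  V⁺-partner {N} {w} {v} (a₀ , (a₀A , na₀) , p) wA t with unsnoc p
  ... | inj₁ refl = ⊥-elim (na₀ (v , t))
  ... | inj₂ (u , p' , r) with A? u
  ...   | yes uA = ⊥-elim (not-both wA (proj₁ (arc-from-A {N} uA r)))
  ...   | no ¬uA with unique N w u v (matched-sym N (proj₂ (arc-from-B {N} (¬A⇒B ¬uA) r))) t
  ...     | refl = a₀ , (a₀A , na₀) , p'

  maximum-no-free-edge : ∀ {N u v} → IsMaximum N → Adj G u v → ¬ Covered N u → ¬ Covered N v → ⊥
  maximum-no-free-edge {N} {u} {v} mx uv nu nv = maximum-covers-most N (addEdge N u v uv nu nv) mx
    (subst (coveredCount N <_) (≡sym (AddEdge.addEdge-count N u v uv nu nv)) (s≤s (m≤n+m (coveredCount N) 1)))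

  -- A maximum matching does not have an alternating path from an uncovered A-vertex
  -- to an uncovered B-vertex (shifting along it would augment).
  no-augmenting-path : ∀ N → IsMaximum N → ∀ {a₀ v} → A₀ side N a₀ → Star (D N) a₀ v → InB side v → ¬ Covered N v → ⊥
  no-augmenting-path N mx (a₀A , na₀) p vB nv = maximum-covers-most N (Shift.result sh) mx
    (subst (coveredCount N <_) (≡sym (Shift.count-more sh (λ vA → not-both vA vB))) (s≤s (m≤n+m (coveredCount N) 1)))
    where
    simple : PathIn p
    simple = simplify p
    sh : Shift N (D N) (proj₁ simple)
    sh = shift N (proj₁ simple) (proj₁ (proj₂ simple)) (λ r _ _ _ _ → r) a₀A na₀ (inj₂ nv)

  V⁺⇒uncovered : (N : Matching G) → IsMaximum N → ∀ {v} → InA side v → V⁺[ N ] v →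
    Σ (Matching G) λ N' → IsMaximum N' × ¬ Covered N' v
  V⁺⇒uncovered N mx vA (a₀ , (a₀A , na₀) , p) =
    Shift.result sh , maximum-if-covers-as-many N (Shift.result sh) mx (≤-reflexive (≡sym (Shift.count-same sh vA))) , Shift.end-free sh vA
    where
    simple : PathIn p
    simple = simplify p
    sh : Shift N (D N) (proj₁ simple)
    sh = shift N (proj₁ simple) (proj₁ (proj₂ simple)) (λ r _ _ _ _ → r) a₀A na₀ (inj₁ vA)

  distance : Matching G → Matching G → ℕ
  distance N N' = ∑ (λ u → ∑ (λ w → indicator (mat N' u w ∧ not (mat N u w))))

  swap-closer : ∀ N N' {v b a} (vb : InM N v b) (nv : ¬ Covered N' v) (ba : InM N' b a) → ¬ InM N a b →
    distance N (Swap.matching (swap N' v b a (sub N v b vb) nv ba)) < distance N N'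
  swap-closer N N' {v} {b} {a} vb nv ba ¬ab =
    ∑-strict {n} (λ u → ∑-mono {n} (pointwise u)) a (∑-strict {n} (pointwise a) b strict)
    where
    sw : Swap N' v b a
    sw = swap N' v b a (sub N v b vb) nv ba
    N″ : Matching G
    N″ = Swap.matching sw
    fewer-new : ∀ x y c → (T x → T y ⊎ T c) → indicator (x ∧ not c) ≤ indicator (y ∧ not c)
    fewer-new false y c h = z≤n
    fewer-new true y true h = z≤n
    fewer-new true true false h = ≤-refl
    fewer-new true false false h with h tt
    ... | inj₁ ()
    ... | inj₂ ()
    pointwise : ∀ u w → indicator (mat N″ u w ∧ not (mat N u w)) ≤ indicator (mat N' u w ∧ not (mat N u w))
    pointwise u w = fewer-new (mat N″ u w) (mat N' u w) (mat N u w) λ t → case Swap.swap⁻ sw t of λ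
      { (inj₁ (t' , _)) → inj₁ t'
      ; (inj₂ (inj₁ (refl , refl))) → inj₂ vb
      ; (inj₂ (inj₂ (refl , refl))) → inj₂ (matched-sym N vb) }
    ¬ab″ : ¬ InM N″ a b
    ¬ab″ t = case Swap.swap⁻ sw t of λ
      { (inj₁ (_ , _ , b≢b)) → b≢b refl
      ; (inj₂ (inj₁ (a≡v , _))) → nv (b , subst (λ z → InM N' z b) a≡v (matched-sym N' ba))
      ; (inj₂ (inj₂ (a≡b , _))) → adj-irrefl (sub N' b a ba) (≡sym a≡b) }
    strict : indicator (mat N″ a b ∧ not (mat N a b)) < indicator (mat N' a b ∧ not (mat N a b))
    strict rewrite ¬T⇒false {mat N″ a b} ¬ab″ | to T-≡ (matched-sym N' ba) | ¬T⇒false {mat N a b} ¬ab = s≤s z≤n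

  -- If v is N-matched to b, then b is N'-matched to some a; exchanging ab for vb in N'
  -- gives a maximum matching closer to N that leaves a uncovered, and a → b → v in D(N).
  uncovered⇒V⁺ : (N N' : Matching G) → IsMaximum N' → ∀ {v} → InA side v → ¬ Covered N' v → V⁺[ N ] v
  uncovered⇒V⁺ N N' = descend (suc (distance N N')) N' ≤-refl
    where
    descend : ∀ k (N' : Matching G) → distance N N' < k → IsMaximum N' → ∀ {v} → InA side v → ¬ Covered N' v → V⁺[ N ] v
    descend (suc k) N' lt mx {v} vA nv with covered? N v
    ... | no nc = v , (vA , nc) , ε
    ... | yes (b , vb) with covered? N' b
    ...   | no nb = ⊥-elim (maximum-no-free-edge {N'} mx (sub N v b vb) nv nb)
    ...   | yes (a , ba) = V⁺-step {N} (V⁺-step {N} a∈V⁺ ab) bv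
      where
      bB : InB side b
      bB = A-nbr-is-B (sub N v b vb) vA
      aA : InA side a
      aA = B-nbr-is-A (sub N' b a ba) bB
      ¬ab : ¬ InM N a b
      ¬ab t = nv (b , subst (λ z → InM N' z b) (unique N b a v (matched-sym N t) (matched-sym N vb)) (matched-sym N' ba))
      sw : Swap N' v b a
      sw = swap N' v b a (sub N v b vb) nv ba
      a∈V⁺ : V⁺[ N ] a
      a∈V⁺ = descend k (Swap.matching sw) (≤-trans (swap-closer N N' vb nv ba ¬ab) (≤-pred lt))
        (maximum-if-covers-as-many N' (Swap.matching sw) mx (≤-reflexive (≡sym (Swap.same-count sw)))) aA (Swap.freed sw)
      ab : D N a b
      ab = inj₁ (aA , bB , adj-sym (sub N' b a ba) , ¬ab)
      bv : D N b v
      bv = inj₂ (bB , vA , matched-sym N vb)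

  -- V⁺(N) is the same set for all maximum matchings N: for A-vertices by the
  -- two lemmas above, and a B-vertex of V⁺ is entered from an A-vertex of V⁺.
  V⁺-invariant-A : (N N' : Matching G) → IsMaximum N → ∀ {v} → InA side v → V⁺[ N ] v → V⁺[ N' ] v
  V⁺-invariant-A N N' mx vA hv = let (N″ , mx″ , nv) = V⁺⇒uncovered N mx vA hv in uncovered⇒V⁺ N' N″ mx″ vA nv

  V⁺-invariant : (N N' : Matching G) → IsMaximum N → ∀ {v} → V⁺[ N ] v → V⁺[ N' ] v
  V⁺-invariant N N' mx {v} hv with A? v
  ... | yes vA = V⁺-invariant-A N N' mx vA hv
  V⁺-invariant N N' mx {v} (a₀ , h₀ , p) | no ¬vA with unsnoc p
  ... | inj₁ refl = ⊥-elim (¬vA (proj₁ h₀))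
  ... | inj₂ (w , p' , r) with A? w
  ...   | no ¬wA = ⊥-elim (¬vA (proj₁ (arc-from-B {N} (¬A⇒B ¬wA) r)))
  ...   | yes wA with V⁺-invariant-A N N' mx wA (a₀ , h₀ , p') | T? (mat N' w v)
  ...     | hw | yes t = V⁺-partner {N'} hw wA t
  ...     | hw | no ¬t = V⁺-step {N'} hw (inj₁ (wA , ¬A⇒B ¬vA , arc-adj {N} r , ¬t))

-- Exchanging the roles of A and B reverses every arc of D(N), so V⁻ for the
-- bipartition (A, B) is V⁺ for (B, A); in particular V⁻ is invariant too.
module SidesExchanged {n} (G : Graph n) (side : Side n) (bip : IsBipartite G side) where
  open Basics {n} {G}

  side′ : Side n
  side′ v = not (side v)

  bip′ : IsBipartite G side′
  bip′ u v uv e = bip u v uv (not-injective e)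

  module _ (N : Matching G) where
    arc-to : ∀ {x y} → Arc G side′ N x y → Arc G side N y x
    arc-to (inj₁ (a , b , xy , ¬m)) = inj₁ (not-injective b , not-injective a , adj-sym xy , ¬m ∘ matched-sym N)
    arc-to (inj₂ (b , a , m)) = inj₂ (not-injective a , not-injective b , matched-sym N m)

    arc-from : ∀ {x y} → Arc G side N y x → Arc G side′ N x y
    arc-from (inj₁ (a , b , yx , ¬m)) = inj₁ (cong not b , cong not a , adj-sym yx , ¬m ∘ matched-sym N)
    arc-from (inj₂ (b , a , m)) = inj₂ (cong not a , cong not b , matched-sym N m)

    V⁻⇒V⁺-exchanged : ∀ {v} → V⁻ G side N v → V⁺ G side′ N v
    V⁻⇒V⁺-exchanged (b , (bB , nb) , p) = b , (cong not bB , nb) , reverse arc-from p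

    V⁺-exchanged⇒V⁻ : ∀ {v} → V⁺ G side′ N v → V⁻ G side N v
    V⁺-exchanged⇒V⁻ (b , (bA , nb) , p) = b , (not-injective bA , nb) , reverse arc-to p

  V⁻-invariant : (N N' : Matching G) → IsMaximum N → ∀ {v} → V⁻ G side N v → V⁻ G side N' v
  V⁻-invariant N N' mx h = V⁺-exchanged⇒V⁻ N' (Alternating.V⁺-invariant G side′ bip′ N N' mx (V⁻⇒V⁺-exchanged N h))

module Consecutive {n : ℕ} where

  Consecutive : List (Fin n) → Fin n → Fin n → Set
  Consecutive [] u w = ⊥
  Consecutive (x ∷ []) u w = ⊥
  Consecutive (x ∷ y ∷ l) u w = (u ≡ x × w ≡ y) ⊎ Consecutive (y ∷ l) u w

  consecutive? : ∀ xs u w → Dec (Consecutive xs u w)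
  consecutive? [] u w = no (λ ())
  consecutive? (x ∷ []) u w = no (λ ())
  consecutive? (x ∷ y ∷ l) u w with u ≟ x | w ≟ y | consecutive? (y ∷ l) u w
  ... | yes u≡x | yes w≡y | _ = yes (inj₁ (u≡x , w≡y))
  ... | _ | _ | yes c = yes (inj₂ c)
  ... | no u≢x | _ | no ¬c = no λ { (inj₁ (u≡x , _)) → u≢x u≡x ; (inj₂ c) → ¬c c }
  ... | yes _ | no w≢y | no ¬c = no λ { (inj₁ (_ , w≡y)) → w≢y w≡y ; (inj₂ c) → ¬c c }

  Consecutive-linked : ∀ {R : Fin n → Fin n → Set} xs → Linked R xs → ∀ {u w} → Consecutive xs u w → R u w
  Consecutive-linked (x ∷ y ∷ l) (r ∷L _) (inj₁ (refl , refl)) = r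
  Consecutive-linked (x ∷ y ∷ l) (_ ∷L lk) (inj₂ c) = Consecutive-linked (y ∷ l) lk c

  Consecutive-∈ : ∀ xs {u w} → Consecutive xs u w → u ∈ xs × w ∈ xs
  Consecutive-∈ (x ∷ y ∷ l) (inj₁ (refl , refl)) = here refl , there (here refl)
  Consecutive-∈ (x ∷ y ∷ l) (inj₂ c) = let (mu , mw) = Consecutive-∈ (y ∷ l) c in there mu , there mw

  Consecutive-++ˡ : ∀ ys zs {u w} → Consecutive ys u w → Consecutive (ys ++ zs) u w
  Consecutive-++ˡ (x ∷ y ∷ l) zs (inj₁ e) = inj₁ e
  Consecutive-++ˡ (x ∷ y ∷ l) zs (inj₂ c) = inj₂ (Consecutive-++ˡ (y ∷ l) zs c)

  lastOf : Fin n → List (Fin n) → Fin n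
  lastOf y [] = y
  lastOf y (y' ∷ ys) = lastOf y' ys

  lastOf-∈ : ∀ y ys → lastOf y ys ∈ y ∷ ys
  lastOf-∈ y [] = here refl
  lastOf-∈ y (y' ∷ ys) = there (lastOf-∈ y' ys)

  lastOf-snoc : ∀ b bs a → lastOf b (bs ++ a ∷ []) ≡ a
  lastOf-snoc b [] a = refl
  lastOf-snoc b (b' ∷ bs) a = lastOf-snoc b' bs a

  Consecutive-last : ∀ y ys z → Consecutive ((y ∷ ys) ++ z ∷ []) (lastOf y ys) z
  Consecutive-last y [] z = inj₁ (refl , refl)
  Consecutive-last y (y' ∷ ys) z = inj₂ (Consecutive-last y' ys z)

  Consecutive-snoc⁻ : ∀ y ys z {u w} → Consecutive ((y ∷ ys) ++ z ∷ []) u w →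
    Consecutive (y ∷ ys) u w ⊎ (u ≡ lastOf y ys × w ≡ z)
  Consecutive-snoc⁻ y [] z (inj₁ e) = inj₂ e
  Consecutive-snoc⁻ y (y' ∷ ys) z (inj₁ e) = inj₁ (inj₁ e)
  Consecutive-snoc⁻ y (y' ∷ ys) z (inj₂ c) with Consecutive-snoc⁻ y' ys z c
  ... | inj₁ c' = inj₁ (inj₂ c')
  ... | inj₂ e = inj₂ e

  closeUp : Fin n → List (Fin n) → List (Fin n)
  closeUp a bs = a ∷ (bs ++ a ∷ [])

  closeUp-∈ : ∀ a bs {u} → u ∈ closeUp a bs → u ∈ a ∷ bs
  closeUp-∈ a bs (here e) = here e
  closeUp-∈ a bs (there m) with ∈-++⁻ bs m
  ... | inj₁ m' = there m'
  ... | inj₂ (here e) = here e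

  close : List (Fin n) → List (Fin n)
  close [] = []
  close (x ∷ xs) = closeUp x xs

  SamePairs : List (Fin n) → List (Fin n) → Set
  SamePairs xs ys = (∀ {u w} → Consecutive xs u w → Consecutive ys u w) × (∀ {u w} → Consecutive ys u w → Consecutive xs u w)

  SamePairs-trans : ∀ {xs ys zs} → SamePairs xs ys → SamePairs ys zs → SamePairs xs zs
  SamePairs-trans (f , g) (f' , g') = f' ∘ f , g ∘ g'

  rotate-once : ∀ a ys → SamePairs (closeUp a ys) (close (ys ++ a ∷ []))
  rotate-once a [] = id , id
  rotate-once a (b ∷ bs) = forth , back
    where
    forth : ∀ {u w} → Consecutive (closeUp a (b ∷ bs)) u w → Consecutive (closeUp b (bs ++ a ∷ [])) u w
    forth (inj₁ (refl , refl)) =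
      subst (λ k → Consecutive ((b ∷ (bs ++ a ∷ [])) ++ b ∷ []) k b) (lastOf-snoc b bs a) (Consecutive-last b (bs ++ a ∷ []) b)
    forth (inj₂ c) = Consecutive-++ˡ (b ∷ (bs ++ a ∷ [])) (b ∷ []) c
    back : ∀ {u w} → Consecutive (closeUp b (bs ++ a ∷ [])) u w → Consecutive (closeUp a (b ∷ bs)) u w
    back c with Consecutive-snoc⁻ b (bs ++ a ∷ []) b c
    ... | inj₁ c' = inj₂ c'
    ... | inj₂ (e₁ , e₂) = inj₁ (trans e₁ (lastOf-snoc b bs a) , e₂)

  rotate-to : ∀ pre u post → Unique (pre ++ u ∷ post) →
    SamePairs (close (pre ++ u ∷ post)) (closeUp u (post ++ pre)) × Unique (u ∷ (post ++ pre))
  rotate-to [] u post uq rewrite ++-identityʳ post = (id , id) , uq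
  rotate-to (p ∷ pre) u post (p∉ ∷ uq) = SamePairs-trans rot₁ (proj₁ rest) , proj₂ rest
    where
    assocˡ : (pre ++ u ∷ post) ++ p ∷ [] ≡ pre ++ u ∷ (post ++ p ∷ [])
    assocˡ = ++-assoc pre (u ∷ post) (p ∷ [])
    assocʳ : (post ++ p ∷ []) ++ pre ≡ post ++ p ∷ pre
    assocʳ = ++-assoc post (p ∷ []) pre
    snoc-unique : Unique (pre ++ u ∷ (post ++ p ∷ []))
    snoc-unique = subst Unique assocˡ (Unique-++⁺ uq ([] ∷ []) λ { (m , here refl) → All¬⇒¬Any p∉ m })
    rest : SamePairs (close (pre ++ u ∷ (post ++ p ∷ []))) (closeUp u (post ++ p ∷ pre)) × Unique (u ∷ (post ++ p ∷ pre))
    rest = subst (λ k → SamePairs (close (pre ++ u ∷ (post ++ p ∷ []))) (closeUp u k) × Unique (u ∷ k)) assocʳ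
                 (rotate-to pre u (post ++ p ∷ []) snoc-unique)
    rot₁ : SamePairs (closeUp p (pre ++ u ∷ post)) (close (pre ++ u ∷ (post ++ p ∷ [])))
    rot₁ = subst (λ k → SamePairs (closeUp p (pre ++ u ∷ post)) (close k)) assocˡ (rotate-once p (pre ++ u ∷ post))

CycleIn-map : ∀ {n} {G : Graph n} {S S' : Fin n → Set} → (∀ {v} → S v → S' v) → CycleIn G S → CycleIn G S'
CycleIn-map f c = record
  { start = CycleIn.start c ; rest = CycleIn.rest c ; long = CycleIn.long c ; distinct = CycleIn.distinct c
  ; inS = mapAll f (CycleIn.inS c) ; closed = CycleIn.closed c }

module OnCycle {n} {G : Graph n} {S : Fin n → Set} (C : CycleIn G S) where
  open Consecutive {n}
  open Basics {n} {G}

  a : Fin n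
  a = CycleIn.start C
  bs : List (Fin n)
  bs = CycleIn.rest C

  L : List (Fin n)
  L = a ∷ bs

  Nbr : Fin n → Fin n → Set
  Nbr u w = Consecutive (closeUp a bs) u w ⊎ Consecutive (closeUp a bs) w u

  Nbr-sym : ∀ {u w} → Nbr u w → Nbr w u
  Nbr-sym (inj₁ c) = inj₂ c
  Nbr-sym (inj₂ c) = inj₁ c

  Nbr-adj : ∀ {u w} → Nbr u w → Adj G u w
  Nbr-adj (inj₁ c) = Consecutive-linked (closeUp a bs) (CycleIn.closed C) c
  Nbr-adj (inj₂ c) = adj-sym (Consecutive-linked (closeUp a bs) (CycleIn.closed C) c)

  Nbr-∈ : ∀ {u w} → Nbr u w → u ∈ L × w ∈ L
  Nbr-∈ (inj₁ c) = let (mu , mw) = Consecutive-∈ (closeUp a bs) c in closeUp-∈ a bs mu , closeUp-∈ a bs mw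
  Nbr-∈ (inj₂ c) = let (mw , mu) = Consecutive-∈ (closeUp a bs) c in closeUp-∈ a bs mu , closeUp-∈ a bs mw

  Nbr? : ∀ u w → Dec (Nbr u w)
  Nbr? u w with consecutive? (closeUp a bs) u w | consecutive? (closeUp a bs) w u
  ... | yes c | _ = yes (inj₁ c)
  ... | no _ | yes c = yes (inj₂ c)
  ... | no ¬c₁ | no ¬c₂ = no λ { (inj₁ c) → ¬c₁ c ; (inj₂ c) → ¬c₂ c }

  -- Every vertex of a cycle has two distinct neighbours on it: rotate the cycle
  -- to start at the vertex and take the second and the second-to-last vertex.
  two-neighbours : ∀ {u} → u ∈ L → Σ (Fin n) λ w₁ → Σ (Fin n) λ w₂ → Nbr u w₁ × Nbr u w₂ × w₁ ≢ w₂
  two-neighbours {u} m with ∈-∃++ m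
  ... | pre , post , L≡ = from-rotation (post ++ pre) pairs (proj₂ rotated) long
    where
    rotated : SamePairs (close (pre ++ u ∷ post)) (closeUp u (post ++ pre)) × Unique (u ∷ (post ++ pre))
    rotated = rotate-to pre u post (subst Unique L≡ (CycleIn.distinct C))
    pairs : SamePairs (closeUp a bs) (closeUp u (post ++ pre))
    pairs = subst (λ k → SamePairs (close k) (closeUp u (post ++ pre))) (≡sym L≡) (proj₁ rotated)
    length-rotated : length bs ≡ length (post ++ pre)
    length-rotated = suc-injective (trans (cong length L≡) (trans (length-++ pre)
      (trans (+-suc (length pre) (length post)) (cong suc (trans (+-comm (length pre) (length post)) (≡sym (length-++ post)))))))
    long : 2 ≤ length (post ++ pre)
    long = subst (2 ≤_) length-rotated (CycleIn.long C)
    from-rotation : ∀ ys → SamePairs (closeUp a bs) (closeUp u ys) → Unique (u ∷ ys) → 2 ≤ length ys →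
      Σ (Fin n) λ w₁ → Σ (Fin n) λ w₂ → Nbr u w₁ × Nbr u w₂ × w₁ ≢ w₂
    from-rotation (b ∷ c ∷ cs) E (_ ∷ (b∉ ∷ _)) _ =
      b , lastOf c cs , inj₁ (proj₂ E (inj₁ (refl , refl))) , inj₂ (proj₂ E (inj₂ (Consecutive-last b (c ∷ cs) u)))
      , λ e → All¬⇒¬Any b∉ (subst (_∈ c ∷ cs) (≡sym e) (lastOf-∈ c cs))
    from-rotation (b ∷ []) _ _ (s≤s ())

  other-neighbour : ∀ {u} → u ∈ L → ∀ m → Σ (Fin n) λ w → Nbr u w × w ≢ m
  other-neighbour u∈L m with two-neighbours u∈L
  ... | w₁ , w₂ , n₁ , n₂ , w₁≢w₂ with w₁ ≟ m
  ...   | yes refl = w₂ , n₂ , w₁≢w₂ ∘ ≡sym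
  ...   | no w₁≢m = w₁ , n₁ , w₁≢m

-- Call a vertex of C deficient for N if no N-edge at it
-- runs along C; every maximum matching N can be replaced by a maximum matching
-- with fewer deficient vertices, which is absurd.
module NoCycleInV⁺ {n} (G : Graph n) (side : Side n) (bip : IsBipartite G side)
    (all-UR : ∀ (N : Matching G) → IsMaximum N → UniquelyRestricted N)
    (M : Matching G) (mxM : IsMaximum M) (C : CycleIn G (V⁺ G side M)) where
  open Basics {n} {G}
  open Walks
  open Alternating G side bip
  open OnCycle C
  open import Data.List.Membership.DecPropositional {A = Fin n} _≟_ using (_∈?_)

  maximum-acyclic : ∀ N → IsMaximum N → ∀ {z} → TransClosure (D N) z z → ⊥
  maximum-acyclic N mx t = all-UR N mx (closed-walk⇒not-UR N t)

  on-C⇒V⁺ : ∀ N → IsMaximum N → ∀ {u} → u ∈ L → V⁺[ N ] u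
  on-C⇒V⁺ N mx m = V⁺-invariant M N mxM (lookupAll (CycleIn.inS C) m)

  -- C is bipartite, so it has an A-vertex.
  some-A-on-C : Σ (Fin n) λ x → x ∈ L × InA side x
  some-A-on-C with A? a
  ... | yes aA = a , here refl , aA
  ... | no ¬aA = let (w , _ , nbr , _) = two-neighbours (here refl) in w , proj₂ (Nbr-∈ nbr) , B-nbr-is-A (Nbr-adj nbr) (¬A⇒B ¬aA)

  record Entry (N : Matching G) : Set where
    field
      c : Fin n
      c∈L : c ∈ L
      cA : InA side c
      a₀ : Fin n
      a₀-free : A₀ side N a₀
      path : Star (D N) a₀ c
      meets-C-at-c : ∀ {u} → u ∈ vertices path → u ∈ L → u ≡ c

  -- Otherwise each A-vertex x of C is reached from
  -- another one: follow a path from A₀(N) to x (x ∈ V⁺) until it first meets C at v.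
  -- If v ∈ A then v ≠ x; if v ∈ B then v is covered (no augmenting path) and its
  -- C-neighbour other than its partner has an arc to v.  This gives a closed walk of D(N).
  entry-exists : ∀ N → IsMaximum N → ¬ ¬ Entry N
  entry-exists N mx ¬entry =
    maximum-acyclic N mx (⁺-reverse-concat (proj₂ (ClosedWalk.closed-walk Before P step (proj₁ some-A-on-C) (proj₂ some-A-on-C))))
    where
    P : Fin n → Set
    P x = x ∈ L × InA side x
    Before : Fin n → Fin n → Set
    Before x y = TransClosure (D N) y x
    step : ∀ x → P x → Σ (Fin n) λ y → Before x y × P y
    step x (x∈L , xA) with on-C⇒V⁺ N mx x∈L
    ... | a₀ , h₀ , p with first-entry L p x∈L
    ...   | v , v∈L , (q , first) , s with A? v
    ...     | yes vA with v ≟ x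
    ...       | yes refl = ⊥-elim (¬entry (record { c = x ; c∈L = x∈L ; cA = xA ; a₀ = a₀ ; a₀-free = h₀ ; path = q ; meets-C-at-c = first }))
    ...       | no v≢x = v , nonempty s v≢x , v∈L , vA
    step x (x∈L , xA) | a₀ , h₀ , p | v , v∈L , (q , first) , s | no ¬vA with covered? N v
    ... | no nv = ⊥-elim (no-augmenting-path N mx h₀ q (¬A⇒B ¬vA) nv)
    ... | yes (m , vm) with other-neighbour v∈L m
    ...   | c' , nbr , c'≢m = c' , (arc ◅⁺ s) , proj₂ (Nbr-∈ nbr) , c'A
      where
      c'A : InA side c'
      c'A = B-nbr-is-A (Nbr-adj nbr) (¬A⇒B ¬vA)
      arc : D N c' v
      arc = inj₁ (c'A , ¬A⇒B ¬vA , Nbr-adj (Nbr-sym nbr) , λ t → c'≢m (unique N v c' m (matched-sym N t) vm))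

  AlongC : Matching G → Fin n → Set
  AlongC N u = Σ (Fin n) λ w → Nbr u w × InM N u w

  AlongC? : ∀ N u → Dec (AlongC N u)
  AlongC? N u = any? (λ w → Nbr? u w ×-dec T? (mat N u w))

  Deficient : Matching G → Fin n → Set
  Deficient N u = u ∈ L × ¬ AlongC N u

  Deficient? : ∀ N u → Dec (Deficient N u)
  Deficient? N u = (u ∈? L) ×-dec ¬? (AlongC? N u)

  deficiency : Matching G → ℕ
  deficiency N = ∑ (λ u → indicator ⌊ Deficient? N u ⌋)

  fewer-deficient : ∀ N N₂ → (∀ u → Deficient N₂ u → Deficient N u) → ∀ k → Deficient N k → ¬ Deficient N₂ k →
    deficiency N₂ < deficiency N
  fewer-deficient N N₂ D₂⊆D k dk ¬d₂k = ∑-strict {n} pointwise k strict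
    where
    pointwise : ∀ u → indicator ⌊ Deficient? N₂ u ⌋ ≤ indicator ⌊ Deficient? N u ⌋
    pointwise u with Deficient? N₂ u | Deficient? N u
    ... | yes _ | yes _ = ≤-refl
    ... | yes d | no ¬d = ⊥-elim (¬d (D₂⊆D u d))
    ... | no _ | _ = z≤n
    strict : indicator ⌊ Deficient? N₂ k ⌋ < indicator ⌊ Deficient? N k ⌋
    strict with Deficient? N₂ k | Deficient? N k
    ... | yes d | _ = ⊥-elim (¬d₂k d)
    ... | no _ | yes _ = s≤s z≤n
    ... | no _ | no ¬d = ⊥-elim (¬d dk)

  -- Shifting N along the entry path uncovers c and keeps all other vertices of C
  -- matched as before; c itself was deficient, its partner preceding it off C.
  shift-to-entry : ∀ N → IsMaximum N → (e : Entry N) →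
    Σ (Matching G) λ N₁ → IsMaximum N₁ × ¬ Covered N₁ (Entry.c e) × (∀ u → Deficient N₁ u → Deficient N u) × Deficient N (Entry.c e)
  shift-to-entry N mx e = N₁ , mx₁ , Shift.end-free sh cA , D₁⊆D , (c∈L , c-not-along)
    where
    open Entry e
    simple : PathIn path
    simple = simplify path
    Q : Star (D N) a₀ c
    Q = proj₁ simple
    uQ : Unique (vertices Q)
    uQ = proj₁ (proj₂ simple)
    meets : ∀ {u} → u ∈ vertices Q → u ∈ L → u ≡ c
    meets m u∈L = meets-C-at-c (proj₂ (proj₂ simple) m) u∈L
    sh : Shift N (D N) Q
    sh = shift N Q uQ (λ r _ _ _ _ → r) (proj₁ a₀-free) (proj₂ a₀-free) (inj₁ cA)
    N₁ : Matching G
    N₁ = Shift.result sh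
    mx₁ : IsMaximum N₁
    mx₁ = maximum-if-covers-as-many N N₁ mx (≤-reflexive (≡sym (Shift.count-same sh cA)))
    c-not-along : ¬ AlongC N c
    c-not-along (w , nbr , cw) with c ≟ a₀
    ... | yes refl = proj₂ a₀-free (w , cw)
    ... | no c≢a₀ with arc-into Q uQ (last∈ Q) c≢a₀
    ...   | u , r , u∈Q , u≢c with A? u
    ...     | yes uA = not-both cA (proj₁ (arc-from-A {N} uA r))
    ...     | no ¬uA with unique N c u w (matched-sym N (proj₂ (arc-from-B {N} (¬A⇒B ¬uA) r))) cw
    ...       | refl = u≢c (meets u∈Q (proj₂ (Nbr-∈ nbr)))
    D₁⊆D : ∀ u → Deficient N₁ u → Deficient N u
    D₁⊆D u (u∈L , ¬along₁) with u ≟ c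
    ... | yes refl = c∈L , c-not-along
    ... | no u≢c = u∈L , λ (w , nbr , uw) → ¬along₁ (w , nbr , subst T (≡sym (Shift.off-path sh u (u≢c ∘ meets' u∈L) w)) uw)
      where
      meets' : ∀ {u} → u ∈ L → u ∈ vertices Q → u ≡ c
      meets' u∈L m = meets m u∈L

  CArc : Matching G → Fin n → Fin n → Set
  CArc N x y = D N x y × Nbr x y

  -- Walking from c along C in D(N) reaches a deficient B-vertex: an A-vertex has a
  -- C-neighbour that is not its partner, and a non-deficient B-vertex is matched
  -- along C.  A walk that never stops would close up in D(N).
  reach-deficient-B : ∀ N → IsMaximum N → ∀ {c} → c ∈ L →
    ¬ ¬ (Σ (Fin n) λ b → Star (CArc N) c b × InB side b × Deficient N b)
  reach-deficient-B N mx {c} c∈L ¬reach =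
    maximum-acyclic N mx (⁺-map proj₁ (proj₂ (ClosedWalk.closed-walk (CArc N) (Star (CArc N) c) step c ε)))
    where
    on-C : ∀ {x} → Star (CArc N) c x → x ∈ L
    on-C p with unsnoc p
    ... | inj₁ refl = c∈L
    ... | inj₂ (_ , _ , (_ , nbr)) = proj₂ (Nbr-∈ nbr)
    next : ∀ x → Star (CArc N) c x → Σ (Fin n) λ y → CArc N x y
    next x px with A? x
    ... | yes xA with two-neighbours (on-C px)
    ...   | w₁ , w₂ , n₁ , n₂ , w₁≢w₂ with T? (mat N x w₁)
    ...     | yes xw₁ = w₂ , inj₁ (xA , A-nbr-is-B (Nbr-adj n₂) xA , Nbr-adj n₂ , λ xw₂ → w₁≢w₂ (unique N x w₁ w₂ xw₁ xw₂)) , n₂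
    ...     | no ¬xw₁ = w₁ , inj₁ (xA , A-nbr-is-B (Nbr-adj n₁) xA , Nbr-adj n₁ , ¬xw₁) , n₁
    next x px | no ¬xA with AlongC? N x
    ... | yes (w , nbr , xw) = w , inj₂ (¬A⇒B ¬xA , B-nbr-is-A (Nbr-adj nbr) (¬A⇒B ¬xA) , xw) , nbr
    ... | no ¬along = ⊥-elim (¬reach (x , px , ¬A⇒B ¬xA , on-C px , ¬along))
    step : ∀ x → Star (CArc N) c x → Σ (Fin n) λ y → CArc N x y × Star (CArc N) c y
    step x px = let (y , r) = next x px in y , r , px ▷ r

  RerouteArc : Matching G → Fin n → Fin n → Fin n → Fin n → Set
  RerouteArc N₁ b y x z = D N₁ x z × (Nbr x z ⊎ (x ≡ b × z ≡ y))

  -- A walk along C from an uncovered c to b, followed by the N₁-edge b → y, contains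
  -- a path from c to y (y, being covered by b, can only be entered through b).
  reroute-path : ∀ N₁ {c b y} → ¬ Covered N₁ c → Star (CArc N₁) c b → InB side b → InM N₁ b y →
    Σ (Star (RerouteArc N₁ b y) c y) λ P → Unique (vertices P)
  reroute-path N₁ {c} {b} {y} c-free s bB by = P₂ ▷ by-arc ,
    subst Unique (≡sym (vertices-▷ P₂ by-arc))
      (Unique-++⁺ (subst Unique (≡sym (proj₂ relabelled)) uP) ([] ∷ [])
                  λ { (m , here refl) → y∉P (subst (y ∈_) (proj₂ relabelled) m) })
    where
    yA : InA side y
    yA = B-nbr-is-A (sub N₁ b y by) bB
    simple : PathIn s
    simple = simplify s
    P : Star (CArc N₁) c b
    P = proj₁ simple
    uP : Unique (vertices P)
    uP = proj₁ (proj₂ simple)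
    y∉P : y ∉ vertices P
    y∉P m with arc-into P uP m (λ y≡c → c-free (subst (Covered N₁) y≡c (b , matched-sym N₁ by)))
    ... | u , (r , _) , _ , u≢b with A? u
    ...   | yes uA = not-both yA (proj₁ (arc-from-A {N₁} uA r))
    ...   | no ¬uA = u≢b (unique N₁ y u b (matched-sym N₁ (proj₂ (arc-from-B {N₁} (¬A⇒B ¬uA) r))) (matched-sym N₁ by))
    relabelled : Σ (Star (RerouteArc N₁ b y) c b) λ P₂ → vertices P₂ ≡ vertices P
    relabelled = relabel P uP (λ (r , nbr) _ _ _ _ → r , inj₁ nbr)
    P₂ : Star (RerouteArc N₁ b y) c b
    P₂ = proj₁ relabelled
    by-arc : RerouteArc N₁ b y b y
    by-arc = inj₂ (bB , yA , by) , inj₂ (refl , refl)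

  -- Let c ∈ A be uncovered by the maximum N₁ and let the deficient b ∈ B be
  -- reached from c along C.  Then b is covered, by y say; shifting N₁ along the path
  -- c ⇝ b → y matches c along C and creates no new deficient vertex.
  reroute : ∀ N₁ → IsMaximum N₁ → ∀ {c b} → InA side c → ¬ Covered N₁ c → Star (CArc N₁) c b → InB side b → Deficient N₁ b →
    Σ (Matching G) λ N₂ → IsMaximum N₂ × (∀ u → Deficient N₂ u → Deficient N₁ u) × ¬ Deficient N₂ c
  reroute N₁ mx₁ {c} {b} cA c-free s bB b-def with covered? N₁ b
  ... | no nb = ⊥-elim (no-augmenting-path N₁ mx₁ (cA , c-free) (mapStar proj₁ s) bB nb)
  ... | yes (y , by) = N₂ , mx₂ , D₂⊆D₁ , c-ok
    where
    yA : InA side y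
    yA = B-nbr-is-A (sub N₁ b y by) bB
    y-covered : Covered N₁ y
    y-covered = b , matched-sym N₁ by
    P₃ : Star (RerouteArc N₁ b y) c y
    P₃ = proj₁ (reroute-path N₁ c-free s bB by)
    sh : Shift N₁ (RerouteArc N₁ b y) P₃
    sh = shift N₁ P₃ (proj₂ (reroute-path N₁ c-free s bB by)) (λ (r , _) _ _ _ _ → r) cA c-free (inj₁ yA)
    N₂ : Matching G
    N₂ = Shift.result sh
    mx₂ : IsMaximum N₂
    mx₂ = maximum-if-covers-as-many N₁ N₂ mx₁ (≤-reflexive (≡sym (Shift.count-same sh yA)))
    y-free : ¬ Covered N₂ y
    y-free = Shift.end-free sh yA
    D₂⊆D₁ : ∀ u → Deficient N₂ u → Deficient N₁ u
    D₂⊆D₁ u (u∈L , ¬along₂) = u∈L , ¬along₁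
      where
      ¬along₁ : ¬ AlongC N₁ u
      ¬along₁ (w , nbr , uw) with u ∈? vertices P₃
      ... | no u∉ = ¬along₂ (w , nbr , subst T (≡sym (Shift.off-path sh u u∉ w)) uw)
      ... | yes m with Shift.on-path sh u m
      ...   | inj₁ (w' , uw' , inj₁ (_ , inj₁ nbr')) = ¬along₂ (w' , nbr' , uw')
      ...   | inj₁ (w' , uw' , inj₁ (_ , inj₂ (_ , w'≡y))) = y-free (u , subst (λ k → InM N₂ k u) w'≡y (matched-sym N₂ uw'))
      ...   | inj₁ (w' , uw' , inj₂ (_ , inj₁ nbr')) = ¬along₂ (w' , Nbr-sym nbr' , uw')
      ...   | inj₁ (w' , uw' , inj₂ (_ , inj₂ (_ , u≡y))) = y-free (w' , subst (λ k → InM N₂ k w') u≡y uw')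
      ...   | inj₂ (u≡y , _) = proj₂ b-def (u , Nbr-sym (subst (Nbr u) (unique N₁ u w b uw (matched-sym N₁ bu)) nbr) , bu)
        where
        bu : InM N₁ b u
        bu = subst (InM N₁ b) (≡sym u≡y) by
    c-ok : ¬ Deficient N₂ c
    c-ok (_ , ¬along₂) with Shift.on-path sh c (first∈ P₃)
    ... | inj₁ (w , cw , inj₁ (_ , inj₁ nbr)) = ¬along₂ (w , nbr , cw)
    ... | inj₁ (_ , _ , inj₁ (_ , inj₂ (c≡b , _))) = not-both cA (subst (InB side) (≡sym c≡b) bB)
    ... | inj₁ (w , cw , inj₂ (_ , inj₁ nbr)) = ¬along₂ (w , Nbr-sym nbr , cw)
    ... | inj₁ (_ , _ , inj₂ (_ , inj₂ (_ , c≡y))) = c-free (subst (Covered N₁) (≡sym c≡y) y-covered)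
    ... | inj₂ (c≡y , _) = c-free (subst (Covered N₁) (≡sym c≡y) y-covered)

  Improvement : Matching G → Set
  Improvement N = Σ (Matching G) λ N₂ → IsMaximum N₂ × deficiency N₂ < deficiency N

  improve : ∀ N → IsMaximum N → ¬ ¬ Improvement N
  improve N mx ¬improvement = entry-exists N mx λ e →
    let open Entry e
        (N₁ , mx₁ , c-free , D₁⊆D , c-deficient) = shift-to-entry N mx e
    in reach-deficient-B N₁ mx₁ c∈L λ (b , s , bB , b-def) →
       let (N₂ , mx₂ , D₂⊆D₁ , c-ok) = reroute N₁ mx₁ cA c-free s bB b-def
       in ¬improvement (N₂ , mx₂ , fewer-deficient N N₂ (λ u → D₁⊆D u ∘ D₂⊆D₁ u) c c-deficient c-ok)

  no-cycle : ⊥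
  no-cycle = descend (suc (deficiency M)) M ≤-refl mxM
    where
    descend : ∀ k N → deficiency N < k → IsMaximum N → ⊥
    descend (suc k) N lt mx = improve N mx λ (N₂ , mx₂ , lt₂) → descend k N₂ (≤-trans lt₂ (≤-pred lt)) mx₂

module Converse {n} (G : Graph n) (side : Side n) (bip : IsBipartite G side)
    (M : Matching G) (mxM : IsMaximum M) (acyclic : Acyclic (Arc G side M))
    (forest⁺ : IsForest G (V⁺ G side M)) (forest⁻ : IsForest G (V⁻ G side M)) where
  open Basics {n} {G}
  open Walks
  open Alternating G side bip
  open SidesExchanged G side bip using (V⁻-invariant)

  -- A closed walk z ⇝ z of D(N) contains a cycle of G whose vertices lie on closed walks
  -- through z (a shortest return path has at least three vertices, as D(N) has no
  -- loops or 2-cycles).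
  closed-walk⇒cycle : ∀ {N z} → TransClosure (D N) z z → CycleIn G (λ v → Star (D N) z v × Star (D N) v z)
  closed-walk⇒cycle {N} [ r ] = ⊥-elim (no-loop {N} r)
  closed-walk⇒cycle {N} {z} (_∷_ {y = y} r t) = from-path (proj₁ simple) (proj₁ (proj₂ simple))
    where
    simple : PathIn (⁺⇒* t)
    simple = simplify (⁺⇒* t)
    from-path : (q : Star (D N) y z) → Unique (vertices q) → CycleIn G (λ v → Star (D N) z v × Star (D N) v z)
    from-path ε _ = ⊥-elim (no-loop {N} r)
    from-path (r₁ ◅ ε) _ = ⊥-elim (no-2-cycle {N} r₁ r)
    from-path q@(r₁ ◅ (r₂ ◅ q')) uq = record
      { start = y ; rest = vertices (r₂ ◅ q') ; long = s≤s (1≤length-vertices q') ; distinct = uq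
      ; inS = tabulateAll (λ m → let (to-v , from-v) = split-at q m in r ◅ to-v , from-v)
      ; closed = vertices-linked (arc-adj {N}) q (arc-adj {N} r) }

  module _ (N : Matching G) (mx : IsMaximum N) where

    Escape : Fin n → Set
    Escape x = ¬ V⁺[ M ] x × ¬ V⁻[ M ] x × Σ (Fin n) λ w → InM N x w × ¬ InM M x w

    -- Each escape vertex has an arc of D(M) to another one: along its N-edge if it is
    -- in A, along its M-edge if it is in B (it is covered, being outside V⁻(M)).
    escape-step : ∀ x → Escape x → Σ (Fin n) λ y → D M x y × Escape y
    escape-step x (x∉V⁺ , x∉V⁻ , (w , xw , ¬Mxw)) with A? x
    ... | yes xA = w , inj₁ (xA , wB , sub N x w xw , ¬Mxw) , w∉V⁺ , w∉V⁻ , (x , matched-sym N xw , ¬Mxw ∘ matched-sym M)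
      where
      wB : InB side w
      wB = A-nbr-is-B (sub N x w xw) xA
      w∉V⁺ : ¬ V⁺[ M ] w
      w∉V⁺ h = x∉V⁺ (V⁺-invariant N M mx (V⁺-step {N} (V⁺-invariant M N mxM h) (inj₂ (wB , xA , matched-sym N xw))))
      w∉V⁻ : ¬ V⁻[ M ] w
      w∉V⁻ h with V⁻-invariant M N mxM h
      ... | b , (_ , nb) , ε = nb (x , matched-sym N xw)
      ... | b , hb , (r ◅ q) with unique N w _ x (proj₂ (arc-from-B {N} wB r)) (matched-sym N xw)
      ...   | refl = x∉V⁻ (V⁻-invariant N M mx (b , hb , q))
    ... | no ¬xA with covered? M x
    ...   | no nx = ⊥-elim (x∉V⁻ (x , (¬A⇒B ¬xA , nx) , ε))
    ...   | yes (w₀ , xw₀) = w₀ , arc , w₀∉V⁺ , (λ (b , hb , q) → x∉V⁻ (b , hb , arc ◅ q)) , differs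
      where
      w₀A : InA side w₀
      w₀A = B-nbr-is-A (sub M x w₀ xw₀) (¬A⇒B ¬xA)
      arc : D M x w₀
      arc = inj₂ (¬A⇒B ¬xA , w₀A , xw₀)
      w₀∉V⁺ : ¬ V⁺[ M ] w₀
      w₀∉V⁺ h = x∉V⁺ (V⁺-partner {M} h w₀A (matched-sym M xw₀))
      differs : Σ (Fin n) λ w' → InM N w₀ w' × ¬ InM M w₀ w'
      differs with covered? N w₀
      ... | no nc = ⊥-elim (w₀∉V⁺ (V⁺-invariant N M mx (w₀ , (w₀A , nc) , ε)))
      ... | yes (w' , w₀w') = w' , w₀w' , λ Mw₀w' → case unique M w₀ w' x Mw₀w' (matched-sym M xw₀) of λ
            { refl → ¬Mxw (subst (InM M x) (unique N x w₀ w (matched-sym N w₀w') xw) xw₀) }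

    -- Without escape vertices, a closed walk of D(N) through z ∉ V⁺(N) ∪ V⁻(N) is a
    -- closed walk of D(M): its vertices avoid V⁺(N) ∪ V⁻(N), where N and M agree.
    transfer : ∀ {z} → ¬ V⁺[ N ] z → ¬ V⁻[ N ] z → ¬ (Σ (Fin n) Escape) → TransClosure (D N) z z → TransClosure (D M) z z
    transfer {z} z∉V⁺ z∉V⁻ no-escape t = let (_ , r , p) = uncons⁺ t in arc ε r p ◅⁺ map-in-context p (λ pre → arc (r ◅ pre))
      where
      arc : ∀ {u v} → Star (D N) z u → D N u v → Star (D N) v z → D M u v
      arc {u} {v} pre r post = same-arc r
        where
        u∉V⁺ : ¬ V⁺[ N ] u
        u∉V⁺ (a₀ , h , p) = z∉V⁺ (a₀ , h , p ◅◅ (r ◅ post))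
        u∉V⁻ : ¬ V⁻[ N ] u
        u∉V⁻ (b , h , q) = z∉V⁻ (b , h , pre ◅◅ q)
        agree : ∀ {w} → InM N u w → InM M u w
        agree {w} uw with T? (mat M u w)
        ... | yes Muw = Muw
        ... | no ¬Muw = ⊥-elim (no-escape (u , (u∉V⁺ ∘ V⁺-invariant M N mxM) , (u∉V⁻ ∘ V⁻-invariant M N mxM) , (w , uw , ¬Muw)))
        same-arc : D N u v → D M u v
        same-arc (inj₁ (uA , vB , uv , ¬Nuv)) = inj₁ (uA , vB , uv , λ Muv → case covered? N u of λ
          { (no nu) → u∉V⁺ (u , (uA , nu) , ε)
          ; (yes (w , uw)) → ¬Nuv (subst (InM N u) (unique M u w v (agree uw) Muv) uw) })
        same-arc (inj₂ (uB , vA , uv)) = inj₂ (uB , vA , agree uv)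

    -- D(N) is acyclic: a closed walk would lie in V⁺ or V⁻ (giving a cycle in a forest
    -- by invariance), or produce a closed walk of D(M) directly or via escape vertices.
    D-acyclic : ∀ {z} → TransClosure (D N) z z → ⊥
    D-acyclic {z} t = ¬¬-excluded-middle λ
      { (yes z∈V⁺) → forest⁺ (CycleIn-map (λ (to-v , _) → V⁺-invariant N M mx (V⁺-reach z∈V⁺ to-v)) (closed-walk⇒cycle {N} t))
      ; (no z∉V⁺) → ¬¬-excluded-middle λ
        { (yes z∈V⁻) → forest⁻ (CycleIn-map (λ (_ , from-v) → V⁻-invariant N M mx (V⁻-reach z∈V⁻ from-v)) (closed-walk⇒cycle {N} t))
        ; (no z∉V⁻) → ¬¬-excluded-middle {A = Σ (Fin n) Escape} λ
          { (yes (x , ex)) → acyclic _ (proj₂ (ClosedWalk.closed-walk (D M) Escape escape-step x ex))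
          ; (no no-escape) → acyclic z (transfer z∉V⁺ z∉V⁻ no-escape t) } } }
      where
      V⁺-reach : ∀ {u v} → V⁺[ N ] u → Star (D N) u v → V⁺[ N ] v
      V⁺-reach (a₀ , h , p) q = a₀ , h , p ◅◅ q
      V⁻-reach : ∀ {u v} → V⁻[ N ] u → Star (D N) v u → V⁻[ N ] v
      V⁻-reach (b , h , p) q = b , h , q ◅◅ p

  all-UR : ∀ N → IsMaximum N → UniquelyRestricted N
  all-UR N mx (N' , same-cover , differ) = D-acyclic N mx (proj₂ (same-cover⇒closed-walk N N' same-cover differ))

theorem10 : ∀ (n : ℕ) (G : Graph n) (side : Side n) → IsBipartite G side →
    (M : Matching G) → IsMaximum M →
      (((M' : Matching G) → IsMaximum M' → UniquelyRestricted M') →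
        Acyclic (Arc G side M) × IsForest G (V⁺ G side M) × IsForest G (V⁻ G side M))
      × ((Acyclic (Arc G side M) × IsForest G (V⁺ G side M) × IsForest G (V⁻ G side M)) →
        (M' : Matching G) → IsMaximum M' → UniquelyRestricted M')
theorem10 n G side bip M mx = necessary , sufficient
  where
  open SidesExchanged G side bip using (side′; bip′; V⁻⇒V⁺-exchanged)
  necessary : ((M' : Matching G) → IsMaximum M' → UniquelyRestricted M') →
    Acyclic (Arc G side M) × IsForest G (V⁺ G side M) × IsForest G (V⁻ G side M)
  necessary all-UR =
      (λ _ t → all-UR M mx (Alternating.closed-walk⇒not-UR G side bip M t))
    , (λ C → NoCycleInV⁺.no-cycle G side bip all-UR M mx C)
    , (λ C → NoCycleInV⁺.no-cycle G side′ bip′ all-UR M mx (CycleIn-map (V⁻⇒V⁺-exchanged M) C))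
  sufficient : Acyclic (Arc G side M) × IsForest G (V⁺ G side M) × IsForest G (V⁻ G side M) →
    (M' : Matching G) → IsMaximum M' → UniquelyRestricted M'
  sufficient (acyclic , forest⁺ , forest⁻) = Converse.all-UR G side bip M mx acyclic forest⁺ forest⁻
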